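{- Let $\{M_d\mid d\ge0\}$ be a nice family. If $i\ge0$ and $d$ are integers with $2i<d$, then $$c_d(i)=\sum_{k=0}^{d-1}W_d(k)\,c_k(k-i)-\sum_{k=0}^{d-1}W_d(k)\,c_k(i-d+k).$$
   Context: Two matroids are identified ($M\simeq M'$) if they have isomorphic lattices of flats. For a matroid $M$ with lattice of flats $L$, minimal flat $\hat0$, Möbius function $\mu$: $M_F$ is the localization (flats $\{G\le F\}$), $M^F$ the contraction (flats $\cong\{G\ge F\}$), $\operatorname{crk}F=\operatorname{rk}M-\operatorname{rk}F$, $\chi_M(t)=\sum_F\mu(\hat0,F)t^{\operatorname{crk}F}$. The Kazhdan–Lusztig polynomial $P_M(t)$ is uniquely determined by: $P_M=1$ if $\operatorname{rk}M=0$; $\deg P_M<\frac12\operatorname{rk}M$ if $\operatorname{rk}M>0$; $t^{\operatorname{rk}M}P_M(t^{ -1})=\sum_F\chi_{M_F}(t)P_{M^F}(t)$. A nice family is a sequence $\{M_d\}$ with $\operatorname{rk}M_d=d$ such that $M_d^F\simeq M_k$ for every corank-$k$ flat $F$ of $M_d$. $W_d(k)$ is the number of flats of $M_d$ of corank $k$, and $c_d(j)$ is the coefficient of $t^j$ in $P_{M_d}(t)$ (zero for $j<0$). -}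

module Defs where

open import Data.Bool using (Bool; true; false; if_then_else_)
import Data.Bool as B
open import Data.Nat as ℕ using (ℕ; zero; suc; _∸_; _≤_; _<_; _≤ᵇ_; _≡ᵇ_)
import Data.Nat.Properties as ℕP
open import Data.Integer as ℤ using (ℤ; +_; -[1+_]; -_; _*_)
open import Data.Fin using (Fin)
open import Data.Fin.Subset using (Subset; _∈_; _∉_; _⊆_; _⊂_; _∪_; _∩_; ⁅_⁆; ⊥; ⊤; ∣_∣; inside; outside)
open import Data.Fin.Subset.Properties using (_∈?_; _⊆?_; _⊂?_)
import Data.Fin.Properties as FinP
open import Data.List using (List; []; _∷_; _++_; map; filter; foldr; length; upTo)
open import Data.Vec using (_∷_; [])
import Data.Vec.Properties as VecP
open import Data.Product using (_×_; _,_)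
open import Data.Sum using (_⊎_)
open import Function.Bundles using (_⇔_)
open import Relation.Nullary using (Dec; yes; no; ¬_)
open import Relation.Nullary.Decidable using (_×-dec_; _→-dec_)
open import Relation.Binary.PropositionalEquality using (_≡_)

record RawMatroid : Set where
  field
    size : ℕ
    rank : Subset size → ℕ
open RawMatroid public

record IsMatroid (M : RawMatroid) : Set where
  field
    rank-bounded : ∀ X → rank M X ≤ ∣ X ∣
    rank-mono    : ∀ X Y → X ⊆ Y → rank M X ≤ rank M Y
    rank-submod  : ∀ X Y → rank M (X ∪ Y) ℕ.+ rank M (X ∩ Y) ≤ rank M X ℕ.+ rank M Y

totalRank : RawMatroid → ℕ
totalRank M = rank M ⊤

Flat : (M : RawMatroid) → Subset (size M) → Set
Flat M X = ∀ e → e ∉ X → rank M X < rank M (X ∪ ⁅ e ⁆)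

flat? : (M : RawMatroid) → (X : Subset (size M)) → Dec (Flat M X)
flat? M X = FinP.all? (λ e → (Relation.Nullary.Decidable.¬? (e ∈? X)) →-dec (rank M X ℕP.<? rank M (X ∪ ⁅ e ⁆)))
  where import Relation.Nullary.Decidable

allSubsets : (n : ℕ) → List (Subset n)
allSubsets zero    = [] ∷ []
allSubsets (suc n) = map (inside ∷_) (allSubsets n) ++ map (outside ∷_) (allSubsets n)

flats : (M : RawMatroid) → List (Subset (size M))
flats M = filter (flat? M) (allSubsets (size M))

closure : (M : RawMatroid) → Subset (size M) → Subset (size M)
closure M X = Data.Vec.tabulate (λ e → rank M (X ∪ ⁅ e ⁆) ≡ᵇ rank M X)
  where import Data.Vec

bottom : (M : RawMatroid) → Subset (size M)
bottom M = closure M ⊥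

crk : (M : RawMatroid) → Subset (size M) → ℕ
crk M F = totalRank M ∸ rank M F

-- Localization M_F (restriction to F; elements outside F become loops,
-- which does not change the lattice of flats up to isomorphism: {G ≤ F}).
loc : (M : RawMatroid) → Subset (size M) → RawMatroid
loc M F = record { size = size M ; rank = λ X → rank M (X ∩ F) }

-- Contraction M^F (elements of F become loops; flats ≅ {G ≥ F}).
con : (M : RawMatroid) → Subset (size M) → RawMatroid
con M F = record { size = size M ; rank = λ X → rank M (X ∪ F) ∸ rank M F }

-- Identification: isomorphic lattices (posets under ⊆) of flats.

record _≃_ (M N : RawMatroid) : Set where
  field
    to       : Subset (size M) → Subset (size N)
    from     : Subset (size N) → Subset (size M)
    to-flat  : ∀ F → Flat M F → Flat N (to F)
    from-flat : ∀ G → Flat N G → Flat M (from G)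
    from-to  : ∀ F → Flat M F → from (to F) ≡ F
    to-from  : ∀ G → Flat N G → to (from G) ≡ G
    to-mono  : ∀ F F′ → Flat M F → Flat M F′ → (F ⊆ F′ ⇔ to F ⊆ to F′)

sumℤ : {A : Set} → List A → (A → ℤ) → ℤ
sumℤ xs f = foldr (λ x acc → f x ℤ.+ acc) (+ 0) xs

_≟S_ : {n : ℕ} → (X Y : Subset n) → Dec (X ≡ Y)
_≟S_ = VecP.≡-dec B._≟_

-- μ(0̂, G) by the recursion μ(0̂,0̂) = 1, μ(0̂,G) = - Σ_{0̂ ≤ H < G} μ(0̂,H),
-- H ranging over flats.  Fuel: a strict chain of subsets of Fin n has
-- length ≤ n + 1, so fuel suc n suffices.
mobFuel : (M : RawMatroid) → ℕ → Subset (size M) → ℤ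
mobFuel M zero    G = + 0
mobFuel M (suc f) G with G ≟S bottom M
... | yes _ = + 1
... | no  _ = - sumℤ (filter (λ H → bottom M ⊆? H ×-dec H ⊂? G) (flats M)) (mobFuel M f)

μ₀ : (M : RawMatroid) → Subset (size M) → ℤ
μ₀ M G = mobFuel M (suc (size M)) G

-- coefficient of t^a in χ_M(t) = Σ_F μ(0̂,F) t^{crk F}
χcoeff : RawMatroid → ℕ → ℤ
χcoeff M a = sumℤ (filter (λ F → crk M F ℕ.≟ a) (flats M)) (μ₀ M)

W : RawMatroid → ℕ → ℕ
W M k = length (filter (λ F → crk M F ℕ.≟ k) (flats M))

-- A polynomial is its coefficient
-- sequence ℕ → ℤ.  P is "the" KL assignment if it is an invariant of
-- matroids up to ≃ and satisfies the defining conditions on every matroid;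
-- these conditions determine P uniquely on matroids.

-- coefficient of t^j in t^{rk M} P_M(t^{-1})
klLHS : (RawMatroid → ℕ → ℤ) → RawMatroid → ℕ → ℤ
klLHS P M j = if j ≤ᵇ totalRank M then P M (totalRank M ∸ j) else + 0

-- coefficient of t^j in Σ_F χ_{M_F}(t) P_{M^F}(t)
klRHS : (RawMatroid → ℕ → ℤ) → RawMatroid → ℕ → ℤ
klRHS P M j = sumℤ (flats M) (λ F →
  sumℤ (upTo (suc j)) (λ a → χcoeff (loc M F) a * P (con M F) (j ∸ a)))

record IsKL (P : RawMatroid → ℕ → ℤ) : Set where
  field
    invariant : ∀ M N → IsMatroid M → IsMatroid N → M ≃ N → ∀ j → P M j ≡ P N j
    rank0     : ∀ M → IsMatroid M → totalRank M ≡ 0 → (P M 0 ≡ + 1) × (∀ j → P M (suc j) ≡ + 0)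
    degree    : ∀ M → IsMatroid M → 0 < totalRank M → ∀ j → totalRank M ≤ 2 ℕ.* j → P M j ≡ + 0
    recursion : ∀ M → IsMatroid M → ∀ j → klLHS P M j ≡ klRHS P M j

record NiceFamily (M : ℕ → RawMatroid) : Set where
  field
    isMatroid   : ∀ d → IsMatroid (M d)
    rank-d      : ∀ d → totalRank (M d) ≡ d
    contraction : ∀ d F → Flat (M d) F → con (M d) F ≃ M (crk (M d) F)

-- c_k(j) for integer j (zero for j < 0)
coeffℤ : (RawMatroid → ℕ → ℤ) → RawMatroid → ℤ → ℤ
coeffℤ P N (+ j)      = P N j
coeffℤ P N -[1+ _ ]   = + 0

module Submission where

-- Apply the defining recursion of P to every contraction M_d^F and sum over all flats F of M_d.
-- On the left, t^{crk F} P_{M^F}(t^{-1}) depends only on crk F because M_d^F ≃ M_{crk F}, so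
-- grouping by corank gives Σ_k W_d(k) c_k(k − i). On the right, the pair F ≤ G contributes
-- χ_{[F,G]}(t) P_{M^G}(t); summing over F first, Σ_{F ≤ G} χ_{[F,G]}(t) = t^{rk G} by Möbius
-- inversion, which leaves Σ_G t^{rk G} P_{M^G}(t) with t^i-coefficient Σ_k W_d(k) c_k(i − d + k).
-- The k = d terms are W_d(d) = 1 times c_d(d − i), which vanishes since 2i < d, and c_d(i).

open import Defs
open import Data.Nat using (ℕ; _<_; _*_)
open import Data.Integer using (ℤ; +_; _-_; _+_) renaming (_*_ to _*ℤ_)
open import Data.List using (upTo)
open import Relation.Binary.PropositionalEquality using (_≡_)

open import Data.Bool using (Bool; true; false; if_then_else_; T; not; _∨_; _xor_)
import Data.Bool.Properties as BoolP
open import Data.Fin using (Fin)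
import Data.Fin.Properties as FinP
open import Data.Fin.Subset hiding (_-_)
open import Data.Fin.Subset.Properties
open import Data.Integer using (-_)
import Data.Integer.Properties as ℤP
open import Data.Integer.Tactic.RingSolver using (solve-∀)
open import Data.List using (List; []; _∷_; _++_; map; filter; length)
import Data.List.Properties as ListP
open import Data.Nat as ℕ using (zero; suc; _≤_; _∸_; z≤n; s≤s)
import Data.Nat.Properties as ℕP
import Data.Nat.Tactic.RingSolver as ℕ-Solver
open import Data.Product using (_×_; _,_; proj₁; proj₂; swap)
open import Data.Sum using (_⊎_; inj₁; inj₂; [_,_])
open import Data.Unit using (tt)
open import Data.Vec using (zipWith; lookup) renaming (_∷_ to _∷ᵥ_; [] to []ᵥ)
import Data.Vec.Properties as VecP
open import Function using (_∘_)
open import Function.Bundles using (Equivalence; mk⇔)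
open import Relation.Binary.PropositionalEquality
  using (_≢_; refl; sym; trans; cong; cong₂; subst; subst₂; module ≡-Reasoning)
open import Relation.Nullary using (Dec; yes; no; ¬_; does; contradiction)
open import Relation.Nullary.Decidable using (_×-dec_)

𝟙 : {P : Set} → Dec P → ℤ
𝟙 d = if does d then + 1 else + 0

module _ {P : Set} where

  𝟙-yes : (d : Dec P) → P → 𝟙 d ≡ + 1
  𝟙-yes (yes _) _ = refl
  𝟙-yes (no ¬p) p = contradiction p ¬p

  𝟙-no : (d : Dec P) → ¬ P → 𝟙 d ≡ + 0
  𝟙-no (yes p) ¬p = contradiction p ¬p
  𝟙-no (no _)  _  = refl

  𝟙-*-cong : (d : Dec P) {a b : ℤ} → (P → a ≡ b) → 𝟙 d *ℤ a ≡ 𝟙 d *ℤ b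
  𝟙-*-cong (yes p) a≡b = cong (+ 1 *ℤ_) (a≡b p)
  𝟙-*-cong (no _)  _   = refl

module _ {P Q : Set} where

  𝟙-cong : (d : Dec P) (e : Dec Q) → (P → Q) → (Q → P) → 𝟙 d ≡ 𝟙 e
  𝟙-cong d e p→q q→p with d | e
  ... | yes _ | yes _ = refl
  ... | yes p | no ¬q = contradiction (p→q p) ¬q
  ... | no ¬p | yes q = contradiction (q→p q) ¬p
  ... | no _  | no _  = refl

  𝟙-× : (d : Dec P) (e : Dec Q) → 𝟙 (d ×-dec e) ≡ 𝟙 d *ℤ 𝟙 e
  𝟙-× (yes _) (yes _) = refl
  𝟙-× (yes _) (no _)  = refl
  𝟙-× (no _)  (yes _) = refl
  𝟙-× (no _)  (no _)  = refl

  𝟙-*-assoc : (d : Dec P) (e : Dec Q) (a : ℤ) → 𝟙 d *ℤ (𝟙 e *ℤ a) ≡ 𝟙 (d ×-dec e) *ℤ a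
  𝟙-*-assoc d e a = trans (sym (ℤP.*-assoc (𝟙 d) (𝟙 e) a)) (cong (_*ℤ a) (sym (𝟙-× d e)))

  𝟙-*-cong₂ : (d : Dec P) (e : Dec Q) {a b : ℤ} → (P → Q) → (Q → P) → (P → a ≡ b) →
              𝟙 d *ℤ a ≡ 𝟙 e *ℤ b
  𝟙-*-cong₂ d e p→q q→p a≡b = trans (𝟙-*-cong d a≡b) (cong (_*ℤ _) (𝟙-cong d e p→q q→p))

module _ {P₁ P₂ Q₁ Q₂ : Set} where

  𝟙-*-𝟙-cong : (d₁ : Dec P₁) (d₂ : Dec P₂) (e₁ : Dec Q₁) (e₂ : Dec Q₂) {a : ℤ} →
               (P₁ × P₂ → Q₁ × Q₂) → (Q₁ × Q₂ → P₁ × P₂) →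
               𝟙 d₁ *ℤ (𝟙 d₂ *ℤ a) ≡ 𝟙 e₁ *ℤ (𝟙 e₂ *ℤ a)
  𝟙-*-𝟙-cong d₁ d₂ e₁ e₂ {a} to from =
    trans (𝟙-*-assoc d₁ d₂ a)
          (trans (cong (_*ℤ a) (𝟙-cong (d₁ ×-dec d₂) (e₁ ×-dec e₂) to from)) (sym (𝟙-*-assoc e₁ e₂ a)))

module _ {A : Set} where

  sumℤ-cong : (xs : List A) {f g : A → ℤ} → (∀ x → f x ≡ g x) → sumℤ xs f ≡ sumℤ xs g
  sumℤ-cong []       f≗g = refl
  sumℤ-cong (x ∷ xs) f≗g = cong₂ _+_ (f≗g x) (sumℤ-cong xs f≗g)

  sumℤ-zero : (xs : List A) {f : A → ℤ} → (∀ x → f x ≡ + 0) → sumℤ xs f ≡ + 0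
  sumℤ-zero []       f≗0 = refl
  sumℤ-zero (x ∷ xs) f≗0 = cong₂ _+_ (f≗0 x) (sumℤ-zero xs f≗0)

  sumℤ-+ : (xs : List A) (f g : A → ℤ) → sumℤ xs (λ x → f x + g x) ≡ sumℤ xs f + sumℤ xs g
  sumℤ-+ []       f g = refl
  sumℤ-+ (x ∷ xs) f g = trans (cong (_+_ (f x + g x)) (sumℤ-+ xs f g))
                              (interchange (f x) (g x) (sumℤ xs f) (sumℤ xs g))
    where
    interchange : ∀ a b c d → (a + b) + (c + d) ≡ (a + c) + (b + d)
    interchange = solve-∀

  sumℤ-*ˡ : (xs : List A) (c : ℤ) (f : A → ℤ) → sumℤ xs (λ x → c *ℤ f x) ≡ c *ℤ sumℤ xs f
  sumℤ-*ˡ []       c f = sym (ℤP.*-zeroʳ c)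
  sumℤ-*ˡ (x ∷ xs) c f = trans (cong (_+_ (c *ℤ f x)) (sumℤ-*ˡ xs c f))
                               (sym (ℤP.*-distribˡ-+ c (f x) (sumℤ xs f)))

  sumℤ-*ʳ : (xs : List A) (c : ℤ) (f : A → ℤ) → sumℤ xs (λ x → f x *ℤ c) ≡ sumℤ xs f *ℤ c
  sumℤ-*ʳ xs c f = trans (sumℤ-cong xs (λ x → ℤP.*-comm (f x) c))
                         (trans (sumℤ-*ˡ xs c f) (ℤP.*-comm c (sumℤ xs f)))

  sumℤ-neg : (xs : List A) (f : A → ℤ) → sumℤ xs (λ x → - f x) ≡ - sumℤ xs f
  sumℤ-neg []       f = refl
  sumℤ-neg (x ∷ xs) f = trans (cong (_+_ (- f x)) (sumℤ-neg xs f))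
                              (sym (ℤP.neg-distrib-+ (f x) (sumℤ xs f)))

  sumℤ-++ : (xs ys : List A) (f : A → ℤ) → sumℤ (xs ++ ys) f ≡ sumℤ xs f + sumℤ ys f
  sumℤ-++ []       ys f = sym (ℤP.+-identityˡ _)
  sumℤ-++ (x ∷ xs) ys f = trans (cong (_+_ (f x)) (sumℤ-++ xs ys f)) (sym (ℤP.+-assoc (f x) _ _))

  sumℤ-filter : (xs : List A) {P : A → Set} (P? : ∀ x → Dec (P x)) (f : A → ℤ) →
                sumℤ (filter P? xs) f ≡ sumℤ xs (λ x → 𝟙 (P? x) *ℤ f x)
  sumℤ-filter []       P? f = refl
  sumℤ-filter (x ∷ xs) P? f with P? x
  ... | yes _ = cong₂ _+_ (sym (ℤP.*-identityˡ (f x))) (sumℤ-filter xs P? f)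
  ... | no  _ = trans (sumℤ-filter xs P? f) (sym (ℤP.+-identityˡ _))

  sumℤ-filter-cong : (xs : List A) {P : A → Set} (P? : ∀ x → Dec (P x)) {f g : A → ℤ} →
                     (∀ x → P x → f x ≡ g x) → sumℤ (filter P? xs) f ≡ sumℤ (filter P? xs) g
  sumℤ-filter-cong xs P? {f} {g} f≗g = trans (sumℤ-filter xs P? f)
    (trans (sumℤ-cong xs (λ x → 𝟙-*-cong (P? x) (f≗g x))) (sym (sumℤ-filter xs P? g)))

  length-filter : (xs : List A) {P : A → Set} (P? : ∀ x → Dec (P x)) →
                  + length (filter P? xs) ≡ sumℤ xs (𝟙 ∘ P?)
  length-filter []       P? = refl
  length-filter (x ∷ xs) P? with P? x
  ... | yes _ = trans (ℤP.pos-+ 1 _) (cong (_+_ (+ 1)) (length-filter xs P?))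
  ... | no  _ = trans (length-filter xs P?) (sym (ℤP.+-identityˡ _))

module _ {A B : Set} where

  sumℤ-map : (xs : List A) (g : A → B) (f : B → ℤ) → sumℤ (map g xs) f ≡ sumℤ xs (f ∘ g)
  sumℤ-map []       g f = refl
  sumℤ-map (x ∷ xs) g f = cong (_+_ (f (g x))) (sumℤ-map xs g f)

  sumℤ-comm : (xs : List A) (ys : List B) (f : A → B → ℤ) →
              sumℤ xs (λ x → sumℤ ys (f x)) ≡ sumℤ ys (λ y → sumℤ xs (λ x → f x y))
  sumℤ-comm []       ys f = sym (sumℤ-zero ys (λ _ → refl))
  sumℤ-comm (x ∷ xs) ys f = trans (cong (_+_ (sumℤ ys (f x))) (sumℤ-comm xs ys f))
                                  (sym (sumℤ-+ ys (f x) _))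

sumℤ-upTo-suc : (m : ℕ) (f : ℕ → ℤ) → sumℤ (upTo (suc m)) f ≡ sumℤ (upTo m) f + f m
sumℤ-upTo-suc m f = begin
  sumℤ (upTo (suc m)) f            ≡⟨ cong (λ xs → sumℤ xs f) (sym (ListP.upTo-∷ʳ m)) ⟩
  sumℤ (upTo m ++ (m ∷ [])) f      ≡⟨ sumℤ-++ (upTo m) (m ∷ []) f ⟩
  sumℤ (upTo m) f + (f m + + 0)    ≡⟨ cong (_+_ (sumℤ (upTo m) f)) (ℤP.+-identityʳ (f m)) ⟩
  sumℤ (upTo m) f + f m            ∎
  where open ≡-Reasoning

sumℤ-upTo-shift : (m : ℕ) (f : ℕ → ℤ) → sumℤ (upTo (suc m)) f ≡ f 0 + sumℤ (upTo m) (f ∘ suc)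
sumℤ-upTo-shift m f =
  cong (_+_ (f 0)) (trans (cong (λ xs → sumℤ xs f) (sym (ListP.map-upTo suc m))) (sumℤ-map (upTo m) suc f))

sumℤ-upTo-𝟙≡ : (m c : ℕ) (f : ℕ → ℤ) →
               sumℤ (upTo m) (λ k → 𝟙 (c ℕ.≟ k) *ℤ f k) ≡ 𝟙 (c ℕ.<? m) *ℤ f c
sumℤ-upTo-𝟙≡ zero    c       f = refl
sumℤ-upTo-𝟙≡ (suc m) zero    f = begin
  sumℤ (upTo (suc m)) (λ k → 𝟙 (0 ℕ.≟ k) *ℤ f k)
    ≡⟨ sumℤ-upTo-shift m (λ k → 𝟙 (0 ℕ.≟ k) *ℤ f k) ⟩
  + 1 *ℤ f 0 + sumℤ (upTo m) (λ k → 𝟙 (0 ℕ.≟ suc k) *ℤ f (suc k))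
    ≡⟨ cong (_+_ (+ 1 *ℤ f 0)) (sumℤ-zero (upTo m) (λ _ → refl)) ⟩
  + 1 *ℤ f 0 + + 0
    ≡⟨ ℤP.+-identityʳ _ ⟩
  + 1 *ℤ f 0
    ≡⟨ cong (_*ℤ f 0) (sym (𝟙-yes (0 ℕ.<? suc m) (s≤s z≤n))) ⟩
  𝟙 (0 ℕ.<? suc m) *ℤ f 0 ∎
  where open ≡-Reasoning
sumℤ-upTo-𝟙≡ (suc m) (suc c) f = begin
  sumℤ (upTo (suc m)) (λ k → 𝟙 (suc c ℕ.≟ k) *ℤ f k)
    ≡⟨ sumℤ-upTo-shift m (λ k → 𝟙 (suc c ℕ.≟ k) *ℤ f k) ⟩
  + 0 + sumℤ (upTo m) (λ k → 𝟙 (suc c ℕ.≟ suc k) *ℤ f (suc k))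
    ≡⟨ ℤP.+-identityˡ _ ⟩
  sumℤ (upTo m) (λ k → 𝟙 (suc c ℕ.≟ suc k) *ℤ f (suc k))
    ≡⟨ sumℤ-cong (upTo m) (λ k → cong (_*ℤ f (suc k))
         (𝟙-cong (suc c ℕ.≟ suc k) (c ℕ.≟ k) ℕP.suc-injective (cong suc))) ⟩
  sumℤ (upTo m) (λ k → 𝟙 (c ℕ.≟ k) *ℤ f (suc k))
    ≡⟨ sumℤ-upTo-𝟙≡ m c (f ∘ suc) ⟩
  𝟙 (c ℕ.<? m) *ℤ f (suc c)
    ≡⟨ cong (_*ℤ f (suc c)) (𝟙-cong (c ℕ.<? m) (suc c ℕ.<? suc m) s≤s ℕP.≤-pred) ⟩
  𝟙 (suc c ℕ.<? suc m) *ℤ f (suc c) ∎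
  where open ≡-Reasoning

sumℤ-by-value : {A : Set} (xs : List A) (v : A → ℕ) (m : ℕ) (g : ℕ → ℤ) → (∀ x → v x < m) →
                sumℤ xs (g ∘ v) ≡ sumℤ (upTo m) (λ k → + length (filter (λ x → v x ℕ.≟ k) xs) *ℤ g k)
sumℤ-by-value xs v m g v<m = sym (begin
  sumℤ (upTo m) (λ k → + length (filter (λ x → v x ℕ.≟ k) xs) *ℤ g k)
    ≡⟨ sumℤ-cong (upTo m) (λ k → trans (cong (_*ℤ g k) (length-filter xs (λ x → v x ℕ.≟ k)))
                                       (sym (sumℤ-*ʳ xs (g k) (λ x → 𝟙 (v x ℕ.≟ k))))) ⟩
  sumℤ (upTo m) (λ k → sumℤ xs (λ x → 𝟙 (v x ℕ.≟ k) *ℤ g k))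
    ≡⟨ sumℤ-comm (upTo m) xs (λ k x → 𝟙 (v x ℕ.≟ k) *ℤ g k) ⟩
  sumℤ xs (λ x → sumℤ (upTo m) (λ k → 𝟙 (v x ℕ.≟ k) *ℤ g k))
    ≡⟨ sumℤ-cong xs (λ x → trans (sumℤ-upTo-𝟙≡ m (v x) g)
                          (trans (cong (_*ℤ g (v x)) (𝟙-yes (v x ℕ.<? m) (v<m x))) (ℤP.*-identityˡ _))) ⟩
  sumℤ xs (g ∘ v) ∎)
  where open ≡-Reasoning

sumℤ-allSubsets-∷ : (n : ℕ) (f : Subset (suc n) → ℤ) →
  sumℤ (allSubsets (suc n)) f ≡ sumℤ (allSubsets n) (f ∘ (true ∷ᵥ_)) + sumℤ (allSubsets n) (f ∘ (false ∷ᵥ_))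
sumℤ-allSubsets-∷ n f = trans (sumℤ-++ (map (true ∷ᵥ_) (allSubsets n)) _ f)
  (cong₂ _+_ (sumℤ-map (allSubsets n) (true ∷ᵥ_) f) (sumℤ-map (allSubsets n) (false ∷ᵥ_) f))

_△_ : {n : ℕ} → Subset n → Subset n → Subset n
_△_ = zipWith _xor_

-- X ↦ m △ X is an involution of the subsets, so it permutes the summands.
sumℤ-allSubsets-△ : (n : ℕ) (m : Subset n) (f : Subset n → ℤ) →
  sumℤ (allSubsets n) (λ X → f (m △ X)) ≡ sumℤ (allSubsets n) f
sumℤ-allSubsets-△ zero    []ᵥ          f = refl
sumℤ-allSubsets-△ (suc n) (false ∷ᵥ m) f = begin
  sumℤ (allSubsets (suc n)) (λ X → f ((false ∷ᵥ m) △ X))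
    ≡⟨ sumℤ-allSubsets-∷ n (λ X → f ((false ∷ᵥ m) △ X)) ⟩
  sumℤ (allSubsets n) (λ X → f (true ∷ᵥ m △ X)) + sumℤ (allSubsets n) (λ X → f (false ∷ᵥ m △ X))
    ≡⟨ cong₂ _+_ (sumℤ-allSubsets-△ n m (f ∘ (true ∷ᵥ_))) (sumℤ-allSubsets-△ n m (f ∘ (false ∷ᵥ_))) ⟩
  sumℤ (allSubsets n) (f ∘ (true ∷ᵥ_)) + sumℤ (allSubsets n) (f ∘ (false ∷ᵥ_))
    ≡⟨ sym (sumℤ-allSubsets-∷ n f) ⟩
  sumℤ (allSubsets (suc n)) f ∎
  where open ≡-Reasoning
sumℤ-allSubsets-△ (suc n) (true ∷ᵥ m) f = begin
  sumℤ (allSubsets (suc n)) (λ X → f ((true ∷ᵥ m) △ X))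
    ≡⟨ sumℤ-allSubsets-∷ n (λ X → f ((true ∷ᵥ m) △ X)) ⟩
  sumℤ (allSubsets n) (λ X → f (false ∷ᵥ m △ X)) + sumℤ (allSubsets n) (λ X → f (true ∷ᵥ m △ X))
    ≡⟨ cong₂ _+_ (sumℤ-allSubsets-△ n m (f ∘ (false ∷ᵥ_))) (sumℤ-allSubsets-△ n m (f ∘ (true ∷ᵥ_))) ⟩
  sumℤ (allSubsets n) (f ∘ (false ∷ᵥ_)) + sumℤ (allSubsets n) (f ∘ (true ∷ᵥ_))
    ≡⟨ ℤP.+-comm (sumℤ (allSubsets n) (f ∘ (false ∷ᵥ_))) _ ⟩
  sumℤ (allSubsets n) (f ∘ (true ∷ᵥ_)) + sumℤ (allSubsets n) (f ∘ (false ∷ᵥ_))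
    ≡⟨ sym (sumℤ-allSubsets-∷ n f) ⟩
  sumℤ (allSubsets (suc n)) f ∎
  where open ≡-Reasoning

𝟙-∷≟∷ : {n : ℕ} (a b : Bool) (X Y : Subset n) →
        𝟙 ((a ∷ᵥ X) ≟S (b ∷ᵥ Y)) ≡ 𝟙 (a BoolP.≟ b) *ℤ 𝟙 (X ≟S Y)
𝟙-∷≟∷ a b X Y = trans (𝟙-cong ((a ∷ᵥ X) ≟S (b ∷ᵥ Y)) ((a BoolP.≟ b) ×-dec (X ≟S Y))
                                VecP.∷-injective (λ (a≡b , X≡Y) → cong₂ _∷ᵥ_ a≡b X≡Y))
                      (𝟙-× (a BoolP.≟ b) (X ≟S Y))

sumℤ-allSubsets-𝟙≡ : (n : ℕ) (Y : Subset n) (g : Subset n → ℤ) →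
                     sumℤ (allSubsets n) (λ X → 𝟙 (X ≟S Y) *ℤ g X) ≡ g Y
sumℤ-allSubsets-𝟙≡ zero    []ᵥ        g = trans (ℤP.+-identityʳ _) (ℤP.*-identityˡ _)
sumℤ-allSubsets-𝟙≡ (suc n) (b ∷ᵥ Y) g = begin
  sumℤ (allSubsets (suc n)) (λ X → 𝟙 (X ≟S (b ∷ᵥ Y)) *ℤ g X)
    ≡⟨ sumℤ-allSubsets-∷ n (λ X → 𝟙 (X ≟S (b ∷ᵥ Y)) *ℤ g X) ⟩
  part true + part false
    ≡⟨ cong₂ _+_ (point true) (point false) ⟩
  𝟙 (true BoolP.≟ b) *ℤ g (true ∷ᵥ Y) + 𝟙 (false BoolP.≟ b) *ℤ g (false ∷ᵥ Y)
    ≡⟨ pick b ⟩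
  g (b ∷ᵥ Y) ∎
  where
  open ≡-Reasoning
  part : Bool → ℤ
  part a = sumℤ (allSubsets n) (λ X → 𝟙 ((a ∷ᵥ X) ≟S (b ∷ᵥ Y)) *ℤ g (a ∷ᵥ X))
  point : ∀ a → part a ≡ 𝟙 (a BoolP.≟ b) *ℤ g (a ∷ᵥ Y)
  point a = begin
    part a
      ≡⟨ sumℤ-cong (allSubsets n) (λ X → trans (cong (_*ℤ g (a ∷ᵥ X)) (𝟙-∷≟∷ a b X Y))
                                               (ℤP.*-assoc (𝟙 (a BoolP.≟ b)) _ _)) ⟩
    sumℤ (allSubsets n) (λ X → 𝟙 (a BoolP.≟ b) *ℤ (𝟙 (X ≟S Y) *ℤ g (a ∷ᵥ X)))
      ≡⟨ sumℤ-*ˡ (allSubsets n) (𝟙 (a BoolP.≟ b)) _ ⟩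
    𝟙 (a BoolP.≟ b) *ℤ sumℤ (allSubsets n) (λ X → 𝟙 (X ≟S Y) *ℤ g (a ∷ᵥ X))
      ≡⟨ cong (𝟙 (a BoolP.≟ b) *ℤ_) (sumℤ-allSubsets-𝟙≡ n Y (g ∘ (a ∷ᵥ_))) ⟩
    𝟙 (a BoolP.≟ b) *ℤ g (a ∷ᵥ Y) ∎
  pick : ∀ b → 𝟙 (true BoolP.≟ b) *ℤ g (true ∷ᵥ Y) + 𝟙 (false BoolP.≟ b) *ℤ g (false ∷ᵥ Y) ≡ g (b ∷ᵥ Y)
  pick true  = trans (ℤP.+-identityʳ _) (ℤP.*-identityˡ _)
  pick false = trans (ℤP.+-identityˡ _) (ℤP.*-identityˡ _)

module _ {n : ℕ} where

  ∪-least : {p q r : Subset n} → p ⊆ r → q ⊆ r → p ∪ q ⊆ r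
  ∪-least {p} {q} p⊆r q⊆r x∈p∪q = [ p⊆r , q⊆r ] (x∈p∪q⁻ p q x∈p∪q)

  ∪-monoˡ-⊆ : {p q : Subset n} (r : Subset n) → p ⊆ q → p ∪ r ⊆ q ∪ r
  ∪-monoˡ-⊆ {q = q} r p⊆q = ∪-least (⊆-trans p⊆q (p⊆p∪q r)) (q⊆p∪q q r)

  q⊆p⇒p∪q≡p : {p q : Subset n} → q ⊆ p → p ∪ q ≡ p
  q⊆p⇒p∪q≡p {p} q⊆p = ⊆-antisym (∪-least ⊆-refl q⊆p) (p⊆p∪q _)

  ⁅x⁆⊆p : {x : Fin n} {p : Subset n} → x ∈ p → ⁅ x ⁆ ⊆ p
  ⁅x⁆⊆p {x} x∈p y∈⁅x⁆ = subst (_∈ _) (sym (x∈⁅y⁆⇒x≡y x y∈⁅x⁆)) x∈p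

  p⊆q⇒p∩q≡p : {p q : Subset n} → p ⊆ q → p ∩ q ≡ p
  p⊆q⇒p∩q≡p {p} {q} p⊆q = ⊆-antisym (p∩q⊆p p q) (λ x∈p → x∈p∩q⁺ (x∈p , p⊆q x∈p))

  ⁅x⁆∩p≡⊥ : {x : Fin n} {p : Subset n} → x ∉ p → ⁅ x ⁆ ∩ p ≡ ⊥
  ⁅x⁆∩p≡⊥ {x} {p} x∉p = ⊆-antisym (λ y∈ → contradiction (x∈p∩q⁻ ⁅ x ⁆ p y∈) λ (y∈⁅x⁆ , y∈p) →
                                      x∉p (subst (_∈ p) (x∈⁅y⁆⇒x≡y x y∈⁅x⁆) y∈p))
                                  ⊥⊆

  Subset-ext : {p q : Subset n} → (∀ x → lookup p x ≡ lookup q x) → p ≡ q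
  Subset-ext {p} {q} p≗q = trans (sym (VecP.tabulate∘lookup p))
                                  (trans (VecP.tabulate-cong p≗q) (VecP.tabulate∘lookup q))

  ∁△≡∪∁ : {G K : Subset n} → K ⊆ G → ∁ G △ K ≡ K ∪ ∁ G
  ∁△≡∪∁ {G} {K} K⊆G = Subset-ext λ x → begin
    lookup (∁ G △ K) x                   ≡⟨ VecP.lookup-zipWith _xor_ x (∁ G) K ⟩
    lookup (∁ G) x xor lookup K x        ≡⟨ cong (_xor lookup K x) (VecP.lookup-map x not G) ⟩
    not (lookup G x) xor lookup K x      ≡⟨ pointwise (lookup G x) (lookup K x) (K⊆G′ x) ⟩
    lookup K x ∨ not (lookup G x)        ≡⟨ cong (lookup K x ∨_) (sym (VecP.lookup-map x not G)) ⟩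
    lookup K x ∨ lookup (∁ G) x          ≡⟨ sym (VecP.lookup-zipWith _∨_ x K (∁ G)) ⟩
    lookup (K ∪ ∁ G) x                   ∎
    where
    open ≡-Reasoning
    K⊆G′ : ∀ x → lookup K x ≡ true → lookup G x ≡ true
    K⊆G′ x k = VecP.[]=⇒lookup (K⊆G (VecP.lookup⇒[]= x K k))
    pointwise : ∀ g k → (k ≡ true → g ≡ true) → not g xor k ≡ k ∨ not g
    pointwise true  k     _   = sym (BoolP.∨-identityʳ k)
    pointwise false false _   = refl
    pointwise false true  k→g = contradiction (k→g refl) (λ ())

  ∪∁-⊆⁻ : {G H K : Subset n} → K ⊆ G → K ∪ ∁ G ⊆ H ∪ ∁ G → K ⊆ H
  ∪∁-⊆⁻ {G} {H} {K} K⊆G K∪∁G⊆H∪∁G {x} x∈K with x∈p∪q⁻ H (∁ G) (K∪∁G⊆H∪∁G (p⊆p∪q (∁ G) x∈K))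
  ... | inj₁ x∈H  = x∈H
  ... | inj₂ x∈∁G = contradiction (K⊆G x∈K) (x∈∁p⇒x∉p x∈∁G)

  ∪∁-⊂⁻ : {G H K : Subset n} → K ⊆ G → K ∪ ∁ G ⊂ H ∪ ∁ G → K ⊂ H
  ∪∁-⊂⁻ {G} {H} {K} K⊆G (⊆ , x , x∈H∪∁G , x∉K∪∁G) with x∈p∪q⁻ H (∁ G) x∈H∪∁G
  ... | inj₁ x∈H  = ∪∁-⊆⁻ K⊆G ⊆ , x , x∈H , x∉K∪∁G ∘ p⊆p∪q (∁ G)
  ... | inj₂ x∈∁G = contradiction (q⊆p∪q K (∁ G) x∈∁G) x∉K∪∁G

  ∪∁-⊂⁺ : {G H K : Subset n} → H ⊆ G → K ⊂ H → K ∪ ∁ G ⊂ H ∪ ∁ G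
  ∪∁-⊂⁺ {G} {H} {K} H⊆G (K⊆H , x , x∈H , x∉K) =
    ∪-monoˡ-⊆ (∁ G) K⊆H , x , p⊆p∪q (∁ G) x∈H ,
    λ x∈K∪∁G → [ x∉K , (λ x∈∁G → x∈∁p⇒x∉p x∈∁G (H⊆G x∈H)) ] (x∈p∪q⁻ K (∁ G) x∈K∪∁G)

  ∁⊆∁△⇒⊆ : {G K : Subset n} → ∁ G ⊆ ∁ G △ K → K ⊆ G
  ∁⊆∁△⇒⊆ {G} {K} ∁G⊆∁G△K {x} x∈K with x ∈? G
  ... | yes x∈G = x∈G
  ... | no  x∉G = contradiction (trans (sym lookup≡false) (VecP.[]=⇒lookup (∁G⊆∁G△K x∈∁G))) λ ()
    where
    x∈∁G : x ∈ ∁ G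
    x∈∁G = x∉p⇒x∈∁p x∉G
    lookup≡false : lookup (∁ G △ K) x ≡ false
    lookup≡false = trans (VecP.lookup-zipWith _xor_ x (∁ G) K)
                         (cong₂ _xor_ (VecP.[]=⇒lookup x∈∁G) (VecP.[]=⇒lookup x∈K))

module _ (M : RawMatroid) {X : Subset (size M)} {e : Fin (size M)} where

  ∈-closure⁺ : rank M (X ∪ ⁅ e ⁆) ≡ rank M X → e ∈ closure M X
  ∈-closure⁺ eq = VecP.lookup⇒[]= e _
    (trans (VecP.lookup∘tabulate _ e) (Equivalence.to BoolP.T-≡ (ℕP.≡⇒≡ᵇ _ _ eq)))

  ∈-closure⁻ : e ∈ closure M X → rank M (X ∪ ⁅ e ⁆) ≡ rank M X
  ∈-closure⁻ e∈cl = ℕP.≡ᵇ⇒≡ _ _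
    (Equivalence.from BoolP.T-≡ (trans (sym (VecP.lookup∘tabulate _ e)) (VecP.[]=⇒lookup e∈cl)))

totalRank-con : (M : RawMatroid) (F : Subset (size M)) → totalRank (con M F) ≡ crk M F
totalRank-con M F = cong (λ Z → rank M Z ∸ rank M F) (∪-zeroˡ F)

≃-of-≗ : {n : ℕ} (ρ ρ′ : Subset n → ℕ) → (∀ X → ρ X ≡ ρ′ X) →
         record { size = n ; rank = ρ } ≃ record { size = n ; rank = ρ′ }
≃-of-≗ ρ ρ′ ρ≗ρ′ = record
  { to        = λ X → X
  ; from      = λ X → X
  ; to-flat   = λ F flat e e∉F → subst₂ _<_ (ρ≗ρ′ F) (ρ≗ρ′ _) (flat e e∉F)
  ; from-flat = λ F flat e e∉F → subst₂ _<_ (sym (ρ≗ρ′ F)) (sym (ρ≗ρ′ _)) (flat e e∉F)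
  ; from-to   = λ _ _ → refl
  ; to-from   = λ _ _ → refl
  ; to-mono   = λ _ _ _ _ → mk⇔ (λ s → s) (λ s → s)
  }

m∸o<n∸o⇒m<n : ∀ {a b c} → a ∸ c < b ∸ c → a < b
m∸o<n∸o⇒m<n {a} {b} {c} lt with ℕP.<-≤-connex a b
... | inj₁ a<b = a<b
... | inj₂ b≤a = contradiction lt (ℕP.≤⇒≯ (ℕP.∸-monoˡ-≤ c b≤a))

[m∸o]∸[n∸o]≡m∸n : ∀ a {b c} → c ≤ b → (a ∸ c) ∸ (b ∸ c) ≡ a ∸ b
[m∸o]∸[n∸o]≡m∸n a {b} {c} c≤b = trans (ℕP.∸-+-assoc a c (b ∸ c)) (cong (a ∸_) (ℕP.m+[n∸m]≡n c≤b))

module _ {M : RawMatroid} (isM : IsMatroid M) where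

  open IsMatroid isM

  private
    r : Subset (size M) → ℕ
    r = rank M

  rank-⊥ : r ⊥ ≡ 0
  rank-⊥ = ℕP.n≤0⇒n≡0 (ℕP.≤-trans (rank-bounded ⊥) (ℕP.≤-reflexive (∣⊥∣≡0 (size M))))

  rank≤totalRank : (X : Subset (size M)) → r X ≤ totalRank M
  rank≤totalRank X = rank-mono X ⊤ ⊆⊤

  rank-∪-loop : (X : Subset (size M)) {e : Fin (size M)} → r ⁅ e ⁆ ≡ 0 → r (X ∪ ⁅ e ⁆) ≤ r X
  rank-∪-loop X {e} loop = begin
    r (X ∪ ⁅ e ⁆)                      ≤⟨ ℕP.m≤m+n _ (r (X ∩ ⁅ e ⁆)) ⟩
    r (X ∪ ⁅ e ⁆) ℕ.+ r (X ∩ ⁅ e ⁆)    ≤⟨ rank-submod X ⁅ e ⁆ ⟩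
    r X ℕ.+ r ⁅ e ⁆                    ≡⟨ cong (r X ℕ.+_) loop ⟩
    r X ℕ.+ 0                          ≡⟨ ℕP.+-identityʳ (r X) ⟩
    r X                                ∎
    where open ℕP.≤-Reasoning

  rank-loops : (X : Subset (size M)) → (∀ {e} → e ∈ X → r ⁅ e ⁆ ≡ 0) → r X ≡ 0
  rank-loops X loops = go (size M) X (∣p∣≤n X) loops
    where
    go : ∀ b Y → ∣ Y ∣ ≤ b → (∀ {e} → e ∈ Y → r ⁅ e ⁆ ≡ 0) → r Y ≡ 0
    go b Y ∣Y∣≤b loops with nonempty? Y
    ... | no Y-empty = trans (cong r (Empty-unique Y-empty)) rank-⊥
    go zero    Y ∣Y∣≤0 loops | yes (e , e∈Y) =
      contradiction (ℕP.<-≤-trans (x∈p⇒∣p-x∣<∣p∣ e∈Y) ∣Y∣≤0) (λ ())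
    go (suc b) Y ∣Y∣≤b loops | yes (e , e∈Y) = ℕP.n≤0⇒n≡0 (begin
      r Y                       ≤⟨ rank-mono Y _ Y⊆[Y-e]∪e ⟩
      r ((Y ─ ⁅ e ⁆) ∪ ⁅ e ⁆)   ≤⟨ rank-∪-loop (Y ─ ⁅ e ⁆) (loops e∈Y) ⟩
      r (Y ─ ⁅ e ⁆)             ≡⟨ go b (Y ─ ⁅ e ⁆) (ℕP.≤-pred (ℕP.<-≤-trans (x∈p⇒∣p-x∣<∣p∣ e∈Y) ∣Y∣≤b))
                                      (loops ∘ p─q⊆p Y ⁅ e ⁆) ⟩
      0                         ∎)
      where
      open ℕP.≤-Reasoning
      Y⊆[Y-e]∪e : Y ⊆ (Y ─ ⁅ e ⁆) ∪ ⁅ e ⁆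
      Y⊆[Y-e]∪e {x} x∈Y with x FinP.≟ e
      ... | yes refl = q⊆p∪q _ _ (x∈⁅x⁆ x)
      ... | no  x≢e  = p⊆p∪q _ (x∈p∧x≢y⇒x∈p-y x∈Y x≢e)

  loop⇒∈bottom : {e : Fin (size M)} → r ⁅ e ⁆ ≡ 0 → e ∈ bottom M
  loop⇒∈bottom {e} loop = ∈-closure⁺ M (trans (cong r (∪-identityˡ ⁅ e ⁆)) (trans loop (sym rank-⊥)))

  ∈bottom⇒loop : {e : Fin (size M)} → e ∈ bottom M → r ⁅ e ⁆ ≡ 0
  ∈bottom⇒loop {e} e∈0̂ = trans (cong r (sym (∪-identityˡ ⁅ e ⁆))) (trans (∈-closure⁻ M e∈0̂) rank-⊥)

  rank-bottom : r (bottom M) ≡ 0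
  rank-bottom = rank-loops (bottom M) ∈bottom⇒loop

  bottom-flat : Flat M (bottom M)
  bottom-flat e e∉0̂ = begin-strict
    r (bottom M)           ≡⟨ rank-bottom ⟩
    0                      <⟨ ℕP.n≢0⇒n>0 (e∉0̂ ∘ loop⇒∈bottom) ⟩
    r ⁅ e ⁆                ≤⟨ rank-mono ⁅ e ⁆ _ (q⊆p∪q _ _) ⟩
    r (bottom M ∪ ⁅ e ⁆)   ∎
    where open ℕP.≤-Reasoning

  bottom⊆flat : (F : Subset (size M)) → Flat M F → bottom M ⊆ F
  bottom⊆flat F flat {e} e∈0̂ with e ∈? F
  ... | yes e∈F = e∈F
  ... | no  e∉F = contradiction (flat e e∉F) (ℕP.≤⇒≯ (rank-∪-loop F (∈bottom⇒loop e∈0̂)))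

  flat-rank0⇒≡bottom : (F : Subset (size M)) → Flat M F → r F ≡ 0 → F ≡ bottom M
  flat-rank0⇒≡bottom F flat rF≡0 = ⊆-antisym
    (λ {e} e∈F → loop⇒∈bottom (ℕP.n≤0⇒n≡0 (subst (r ⁅ e ⁆ ≤_) rF≡0 (rank-mono ⁅ e ⁆ F (⁅x⁆⊆p e∈F)))))
    (bottom⊆flat F flat)

  con-isMatroid : (F : Subset (size M)) → IsMatroid (con M F)
  con-isMatroid F = record
    { rank-bounded = λ X → ℕP.m≤n+o⇒m∸n≤o (r (X ∪ F)) (r F) (begin
        r (X ∪ F)                   ≤⟨ ℕP.m≤m+n _ (r (X ∩ F)) ⟩
        r (X ∪ F) ℕ.+ r (X ∩ F)     ≤⟨ rank-submod X F ⟩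
        r X ℕ.+ r F                 ≤⟨ ℕP.+-monoˡ-≤ (r F) (rank-bounded X) ⟩
        ∣ X ∣ ℕ.+ r F               ≡⟨ ℕP.+-comm ∣ X ∣ (r F) ⟩
        r F ℕ.+ ∣ X ∣               ∎)
    ; rank-mono = λ X Y X⊆Y → ℕP.∸-monoˡ-≤ (r F) (rank-mono _ _ (∪-monoˡ-⊆ F X⊆Y))
    ; rank-submod = λ X Y → ℕP.+-cancelʳ-≤ (r F ℕ.+ r F) _ _ (begin
        (r ((X ∪ Y) ∪ F) ∸ r F) ℕ.+ (r ((X ∩ Y) ∪ F) ∸ r F) ℕ.+ (r F ℕ.+ r F)
          ≡⟨ restore (r ((X ∪ Y) ∪ F)) (r ((X ∩ Y) ∪ F)) (F⊆∪F (X ∪ Y)) (F⊆∪F (X ∩ Y)) ⟩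
        r ((X ∪ Y) ∪ F) ℕ.+ r ((X ∩ Y) ∪ F)
          ≡⟨ cong₂ (λ A B → r A ℕ.+ r B) (∪-∪-distrib X Y) (∪-distribʳ-∩ F X Y) ⟩
        r ((X ∪ F) ∪ (Y ∪ F)) ℕ.+ r ((X ∪ F) ∩ (Y ∪ F))
          ≤⟨ rank-submod (X ∪ F) (Y ∪ F) ⟩
        r (X ∪ F) ℕ.+ r (Y ∪ F)
          ≡⟨ sym (restore (r (X ∪ F)) (r (Y ∪ F)) (F⊆∪F X) (F⊆∪F Y)) ⟩
        (r (X ∪ F) ∸ r F) ℕ.+ (r (Y ∪ F) ∸ r F) ℕ.+ (r F ℕ.+ r F) ∎)
    }
    where
    open ℕP.≤-Reasoning
    F⊆∪F : ∀ X → r F ≤ r (X ∪ F)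
    F⊆∪F X = rank-mono F (X ∪ F) (q⊆p∪q X F)
    ∪-∪-distrib : ∀ X Y → (X ∪ Y) ∪ F ≡ (X ∪ F) ∪ (Y ∪ F)
    ∪-∪-distrib X Y = ⊆-antisym
      (∪-least (∪-least (⊆-trans (p⊆p∪q F) (p⊆p∪q (Y ∪ F))) (⊆-trans (p⊆p∪q F) (q⊆p∪q (X ∪ F) (Y ∪ F))))
               (⊆-trans (q⊆p∪q X F) (p⊆p∪q (Y ∪ F))))
      (∪-least (∪-monoˡ-⊆ F (p⊆p∪q Y)) (∪-monoˡ-⊆ F (q⊆p∪q X Y)))
    restore : ∀ a b → r F ≤ a → r F ≤ b → (a ∸ r F) ℕ.+ (b ∸ r F) ℕ.+ (r F ℕ.+ r F) ≡ a ℕ.+ b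
    restore a b F≤a F≤b = trans (rearrange (a ∸ r F) (b ∸ r F) (r F))
                                (cong₂ ℕ._+_ (ℕP.m∸n+n≡m F≤a) (ℕP.m∸n+n≡m F≤b))
      where
      rearrange : ∀ p q s → p ℕ.+ q ℕ.+ (s ℕ.+ s) ≡ (p ℕ.+ s) ℕ.+ (q ℕ.+ s)
      rearrange = ℕ-Solver.solve-∀

  rank-con-⊇ : {F X : Subset (size M)} → F ⊆ X → rank (con M F) X ≡ r X ∸ r F
  rank-con-⊇ {F} F⊆X = cong (λ Z → r Z ∸ r F) (q⊆p⇒p∪q≡p F⊆X)

  flat-con⁻ : (F X : Subset (size M)) → Flat (con M F) X → F ⊆ X × Flat M X
  flat-con⁻ F X flat = F⊆X , λ e e∉X →
    m∸o<n∸o⇒m<n {c = r F} (subst₂ _<_ (rank-con-⊇ F⊆X) (rank-con-⊇ (⊆-trans F⊆X (p⊆p∪q ⁅ e ⁆))) (flat e e∉X))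
    where
    F⊆X : F ⊆ X
    F⊆X {e} e∈F with e ∈? X
    ... | yes e∈X = e∈X
    ... | no  e∉X = contradiction (subst (λ Z → rank (con M F) X < r Z ∸ r F) absorb (flat e e∉X))
                                  (ℕP.<-irrefl refl)
      where
      absorb : (X ∪ ⁅ e ⁆) ∪ F ≡ X ∪ F
      absorb = ⊆-antisym (∪-least (∪-least (p⊆p∪q F) (⊆-trans (⁅x⁆⊆p e∈F) (q⊆p∪q X F))) (q⊆p∪q X F))
                         (∪-monoˡ-⊆ F (p⊆p∪q ⁅ e ⁆))

  flat-con⁺ : (F X : Subset (size M)) → F ⊆ X → Flat M X → Flat (con M F) X
  flat-con⁺ F X F⊆X flat e e∉X =
    subst₂ _<_ (sym (rank-con-⊇ F⊆X)) (sym (rank-con-⊇ (⊆-trans F⊆X (p⊆p∪q ⁅ e ⁆))))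
           (ℕP.∸-monoˡ-< (flat e e∉X) (rank-mono F X F⊆X))

  con-con≃ : {F G : Subset (size M)} → F ⊆ G → con (con M F) G ≃ con M G
  con-con≃ {F} {G} F⊆G = ≃-of-≗ _ _ λ X → begin
    (r ((X ∪ G) ∪ F) ∸ r F) ∸ (r (G ∪ F) ∸ r F)
      ≡⟨ cong₂ (λ A B → (r A ∸ r F) ∸ (r B ∸ r F)) (q⊆p⇒p∪q≡p (⊆-trans F⊆G (q⊆p∪q X G)))
                                                     (q⊆p⇒p∪q≡p F⊆G) ⟩
    (r (X ∪ G) ∸ r F) ∸ (r G ∸ r F)
      ≡⟨ [m∸o]∸[n∸o]≡m∸n (r (X ∪ G)) (rank-mono F G F⊆G) ⟩
    r (X ∪ G) ∸ r G ∎
    where open ≡-Reasoning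

  flat-within-flat : {G K : Subset (size M)} → Flat M G → K ⊆ G →
                     (∀ e → e ∈ G → e ∉ K → r K < r (K ∪ ⁅ e ⁆)) → Flat M K
  flat-within-flat {G} {K} flat-G K⊆G closed-in-G e e∉K with e ∈? G
  ... | yes e∈G = closed-in-G e e∈G e∉K
  ... | no  e∉G with ℕP.<-≤-connex (r K) (r (K ∪ ⁅ e ⁆))
  ...   | inj₁ K<K+e = K<K+e
  ...   | inj₂ K+e≤K = contradiction (flat-G e e∉G) (ℕP.≤⇒≯ (ℕP.+-cancelʳ-≤ (r K) _ _ (begin
    r (G ∪ ⁅ e ⁆) ℕ.+ r K                          ≡⟨ cong₂ (λ A B → r A ℕ.+ r B) (sym union) (sym intersection) ⟩
    r ((K ∪ ⁅ e ⁆) ∪ G) ℕ.+ r ((K ∪ ⁅ e ⁆) ∩ G)    ≤⟨ rank-submod (K ∪ ⁅ e ⁆) G ⟩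
    r (K ∪ ⁅ e ⁆) ℕ.+ r G                          ≤⟨ ℕP.+-monoˡ-≤ (r G) K+e≤K ⟩
    r K ℕ.+ r G                                    ≡⟨ ℕP.+-comm (r K) (r G) ⟩
    r G ℕ.+ r K                                    ∎)))
    where
    open ℕP.≤-Reasoning
    union : (K ∪ ⁅ e ⁆) ∪ G ≡ G ∪ ⁅ e ⁆
    union = ⊆-antisym (∪-least (∪-monoˡ-⊆ ⁅ e ⁆ K⊆G) (p⊆p∪q ⁅ e ⁆))
                      (∪-least (q⊆p∪q (K ∪ ⁅ e ⁆) G) (⊆-trans (q⊆p∪q K ⁅ e ⁆) (p⊆p∪q G)))
    intersection : (K ∪ ⁅ e ⁆) ∩ G ≡ K
    intersection = trans (∩-distribʳ-∪ G K ⁅ e ⁆)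
                         (trans (cong₂ _∪_ (p⊆q⇒p∩q≡p K⊆G) (⁅x⁆∩p≡⊥ e∉G)) (∪-identityʳ K))

-- loc (con M F) G has rank X ↦ r (clamp F G X) ∸ r F, so its flats are the K ∪ ∁ G with K a flat of M
-- between F and G; it models the interval [F, G] of the lattice of flats.
clamp : {n : ℕ} → Subset n → Subset n → Subset n → Subset n
clamp F G X = (X ∩ G) ∪ F

module _ {n : ℕ} {F G : Subset n} where

  clamp-∪ : (X Y : Subset n) → clamp F G (X ∪ Y) ≡ clamp F G X ∪ (Y ∩ G)
  clamp-∪ X Y = begin
    ((X ∪ Y) ∩ G) ∪ F            ≡⟨ cong (_∪ F) (∩-distribʳ-∪ G X Y) ⟩
    ((X ∩ G) ∪ (Y ∩ G)) ∪ F      ≡⟨ ∪-assoc (X ∩ G) (Y ∩ G) F ⟩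
    (X ∩ G) ∪ ((Y ∩ G) ∪ F)      ≡⟨ cong ((X ∩ G) ∪_) (∪-comm (Y ∩ G) F) ⟩
    (X ∩ G) ∪ (F ∪ (Y ∩ G))      ≡⟨ sym (∪-assoc (X ∩ G) F (Y ∩ G)) ⟩
    ((X ∩ G) ∪ F) ∪ (Y ∩ G)      ∎
    where open ≡-Reasoning

  clamp-∪-outside : (X : Subset n) {e : Fin n} → e ∉ G ⊎ e ∈ F → clamp F G (X ∪ ⁅ e ⁆) ≡ clamp F G X
  clamp-∪-outside X {e} e∉G∖F = trans (clamp-∪ X ⁅ e ⁆) (q⊆p⇒p∪q≡p (e∩G⊆clamp e∉G∖F))
    where
    e∩G⊆clamp : e ∉ G ⊎ e ∈ F → ⁅ e ⁆ ∩ G ⊆ clamp F G X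
    e∩G⊆clamp (inj₁ e∉G) = subst (_⊆ clamp F G X) (sym (⁅x⁆∩p≡⊥ e∉G)) ⊥⊆
    e∩G⊆clamp (inj₂ e∈F) = ⊆-trans (p∩q⊆p ⁅ e ⁆ G) (⊆-trans (⁅x⁆⊆p e∈F) (q⊆p∪q (X ∩ G) F))

  clamp-∪-inside : (X : Subset n) {e : Fin n} → e ∈ G → clamp F G (X ∪ ⁅ e ⁆) ≡ clamp F G X ∪ ⁅ e ⁆
  clamp-∪-inside X e∈G = trans (clamp-∪ X _) (cong (clamp F G X ∪_) (p⊆q⇒p∩q≡p (⁅x⁆⊆p e∈G)))

  clamp-∪∁ : {K : Subset n} → F ⊆ K → K ⊆ G → clamp F G (K ∪ ∁ G) ≡ K
  clamp-∪∁ {K} F⊆K K⊆G = begin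
    clamp F G (K ∪ ∁ G)           ≡⟨ clamp-∪ K (∁ G) ⟩
    ((K ∩ G) ∪ F) ∪ (∁ G ∩ G)     ≡⟨ cong₂ (λ A B → (A ∪ F) ∪ B) (p⊆q⇒p∩q≡p K⊆G) (∩-inverseˡ G) ⟩
    (K ∪ F) ∪ ⊥                   ≡⟨ ∪-identityʳ (K ∪ F) ⟩
    K ∪ F                         ≡⟨ q⊆p⇒p∪q≡p F⊆K ⟩
    K                             ∎
    where open ≡-Reasoning

  clamp-⊤ : F ⊆ G → clamp F G ⊤ ≡ G
  clamp-⊤ F⊆G = trans (cong (_∪ F) (∩-identityˡ G)) (q⊆p⇒p∪q≡p F⊆G)

  clamp-⊥ : clamp F G ⊥ ≡ F
  clamp-⊥ = trans (cong (_∪ F) (∩-zeroˡ G)) (∪-identityˡ F)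

∪∁-injective : {n : ℕ} {G K K′ : Subset n} → K ⊆ G → K′ ⊆ G → K ∪ ∁ G ≡ K′ ∪ ∁ G → K ≡ K′
∪∁-injective K⊆G K′⊆G eq =
  trans (sym (clamp-∪∁ ⊥⊆ K⊆G)) (trans (cong (clamp ⊥ _) eq) (clamp-∪∁ ⊥⊆ K′⊆G))

mobius : (M : RawMatroid) → Subset (size M) → ℕ → Subset (size M) → ℤ
mobius M F zero    H = + 0
mobius M F (suc f) H with H ≟S F
... | yes _ = + 1
... | no  _ = - sumℤ (allSubsets (size M)) (λ K → 𝟙 (flat? M K ×-dec (F ⊆? K ×-dec K ⊂? H)) *ℤ mobius M F f K)

μ : (M : RawMatroid) → Subset (size M) → Subset (size M) → ℤ
μ M F H = mobius M F (suc (size M)) H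

χ-interval : (M : RawMatroid) → Subset (size M) → Subset (size M) → ℕ → ℤ
χ-interval M F G a = sumℤ (allSubsets (size M)) (λ K →
  𝟙 (flat? M K ×-dec (F ⊆? K ×-dec (K ⊆? G ×-dec (rank M G ∸ rank M K ℕ.≟ a)))) *ℤ μ M F K)

module _ {M : RawMatroid} (isM : IsMatroid M) {F G : Subset (size M)}
         (flat-F : Flat M F) (flat-G : Flat M G) (F⊆G : F ⊆ G) where

  open IsMatroid isM

  private
    r : Subset (size M) → ℕ
    r = rank M
    N : RawMatroid
    N = loc (con M F) G
    all : List (Subset (size M))
    all = allSubsets (size M)

  rank-interval : {K : Subset (size M)} → F ⊆ K → K ⊆ G → rank N (K ∪ ∁ G) ≡ r K ∸ r F
  rank-interval F⊆K K⊆G = cong (λ Z → r Z ∸ r F) (clamp-∪∁ F⊆K K⊆G)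

  rank-interval-∪ : {K : Subset (size M)} {e : Fin (size M)} → F ⊆ K → K ⊆ G → e ∈ G →
                    rank N ((K ∪ ∁ G) ∪ ⁅ e ⁆) ≡ r (K ∪ ⁅ e ⁆) ∸ r F
  rank-interval-∪ {K} F⊆K K⊆G e∈G =
    cong (λ Z → r Z ∸ r F) (trans (clamp-∪-inside (K ∪ ∁ G) e∈G) (cong (_∪ ⁅ _ ⁆) (clamp-∪∁ F⊆K K⊆G)))

  flat-interval⁻ : (K : Subset (size M)) → Flat N (∁ G △ K) → Flat M K × F ⊆ K × K ⊆ G
  flat-interval⁻ K flat = flat-within-flat isM flat-G K⊆G closed , F⊆K , K⊆G
    where
    X : Subset (size M)
    X = ∁ G △ K
    forced : ∀ {e} → e ∉ G ⊎ e ∈ F → e ∈ X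
    forced {e} e∉G∖F with e ∈? X
    ... | yes e∈X = e∈X
    ... | no  e∉X = contradiction (subst (λ Z → rank N X < r Z ∸ r F) (clamp-∪-outside X e∉G∖F) (flat e e∉X))
                                  (ℕP.<-irrefl refl)
    K⊆G : K ⊆ G
    K⊆G = ∁⊆∁△⇒⊆ (forced ∘ inj₁ ∘ x∈∁p⇒x∉p)
    X≡K∪∁G : X ≡ K ∪ ∁ G
    X≡K∪∁G = ∁△≡∪∁ K⊆G
    F⊆K : F ⊆ K
    F⊆K {e} e∈F with x∈p∪q⁻ K (∁ G) (subst (e ∈_) X≡K∪∁G (forced (inj₂ e∈F)))
    ... | inj₁ e∈K  = e∈K
    ... | inj₂ e∈∁G = contradiction (F⊆G e∈F) (x∈∁p⇒x∉p e∈∁G)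
    closed : ∀ e → e ∈ G → e ∉ K → r K < r (K ∪ ⁅ e ⁆)
    closed e e∈G e∉K = m∸o<n∸o⇒m<n {c = r F}
      (subst₂ _<_ (trans (cong (rank N) X≡K∪∁G) (rank-interval F⊆K K⊆G))
                  (trans (cong (λ Z → rank N (Z ∪ ⁅ e ⁆)) X≡K∪∁G) (rank-interval-∪ F⊆K K⊆G e∈G))
                  (flat e (λ e∈X → [ e∉K , (λ e∈∁G → x∈∁p⇒x∉p e∈∁G e∈G) ]
                                     (x∈p∪q⁻ K (∁ G) (subst (e ∈_) X≡K∪∁G e∈X)))))

  flat-interval⁺ : (K : Subset (size M)) → Flat M K → F ⊆ K → K ⊆ G → Flat N (∁ G △ K)
  flat-interval⁺ K flat F⊆K K⊆G e e∉X = subst₂ _<_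
    (sym (trans (cong (rank N) X≡K∪∁G) (rank-interval F⊆K K⊆G)))
    (sym (trans (cong (λ Z → rank N (Z ∪ ⁅ e ⁆)) X≡K∪∁G) (rank-interval-∪ F⊆K K⊆G e∈G)))
    (ℕP.∸-monoˡ-< (flat e (e∉X ∘ subst (e ∈_) (sym X≡K∪∁G) ∘ p⊆p∪q (∁ G))) (rank-mono F K F⊆K))
    where
    X≡K∪∁G : ∁ G △ K ≡ K ∪ ∁ G
    X≡K∪∁G = ∁△≡∪∁ K⊆G
    e∈G : e ∈ G
    e∈G with e ∈? G
    ... | yes e∈G = e∈G
    ... | no  e∉G = contradiction (subst (e ∈_) (sym X≡K∪∁G) (q⊆p∪q K (∁ G) (x∉p⇒x∈∁p e∉G))) e∉X

  bottom-interval : bottom N ≡ F ∪ ∁ G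
  bottom-interval = ⊆-antisym ⊆F∪∁G F∪∁G⊆
    where
    rank-N-⊥ : rank N ⊥ ≡ 0
    rank-N-⊥ = trans (cong (λ Z → r Z ∸ r F) clamp-⊥) (ℕP.n∸n≡0 (r F))
    ⊆F∪∁G : bottom N ⊆ F ∪ ∁ G
    ⊆F∪∁G {e} e∈0̂ with e ∈? F | e ∈? G
    ... | yes e∈F | _       = p⊆p∪q (∁ G) e∈F
    ... | no  _   | no  e∉G = q⊆p∪q F (∁ G) (x∉p⇒x∈∁p e∉G)
    ... | no  e∉F | yes e∈G = contradiction (trans (∈-closure⁻ N e∈0̂) rank-N-⊥) (ℕP.>⇒≢ (begin-strict
      0                                 <⟨ ℕP.m<n⇒0<n∸m (flat-F e e∉F) ⟩
      r (F ∪ ⁅ e ⁆) ∸ r F               ≡⟨ cong (λ Z → r (Z ∪ ⁅ e ⁆) ∸ r F) (sym clamp-⊥) ⟩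
      r (clamp F G ⊥ ∪ ⁅ e ⁆) ∸ r F     ≡⟨ cong (λ Z → r Z ∸ r F) (sym (clamp-∪-inside ⊥ e∈G)) ⟩
      rank N (⊥ ∪ ⁅ e ⁆)                ∎))
      where open ℕP.≤-Reasoning
    F∪∁G⊆ : F ∪ ∁ G ⊆ bottom N
    F∪∁G⊆ {e} e∈F∪∁G = ∈-closure⁺ N (cong (λ Z → r Z ∸ r F) (clamp-∪-outside ⊥
      ([ inj₂ , inj₁ ∘ x∈∁p⇒x∉p ] (x∈p∪q⁻ F (∁ G) e∈F∪∁G))))

  crk-interval : {K : Subset (size M)} → F ⊆ K → K ⊆ G → crk N (K ∪ ∁ G) ≡ r G ∸ r K
  crk-interval {K} F⊆K K⊆G = begin
    crk N (K ∪ ∁ G)                      ≡⟨ cong₂ (λ A B → (r A ∸ r F) ∸ B) (clamp-⊤ F⊆G) (rank-interval F⊆K K⊆G) ⟩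
    (r G ∸ r F) ∸ (r K ∸ r F)            ≡⟨ [m∸o]∸[n∸o]≡m∸n (r G) (rank-mono F K F⊆K) ⟩
    r G ∸ r K                            ∎
    where open ≡-Reasoning

  -- Reindex by K ↦ ∁ G △ K: a bijection of all subsets that agrees with K ↦ K ∪ ∁ G when K ⊆ G.
  sumℤ-flats-interval :
    {Q : Subset (size M) → Set} (Q? : ∀ Y → Dec (Q Y)) {T : Subset (size M) → Set} (T? : ∀ K → Dec (T K))
    (g h : Subset (size M) → ℤ) →
    (∀ K → Flat M K → F ⊆ K → K ⊆ G → Q (K ∪ ∁ G) → T K) →
    (∀ K → T K → Flat M K × F ⊆ K × K ⊆ G × Q (K ∪ ∁ G)) →
    (∀ K → F ⊆ K → K ⊆ G → g (K ∪ ∁ G) ≡ h K) →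
    sumℤ (filter Q? (flats N)) g ≡ sumℤ all (λ K → 𝟙 (T? K) *ℤ h K)
  sumℤ-flats-interval {Q} Q? {T} T? g h to from value = begin
    sumℤ (filter Q? (flats N)) g
      ≡⟨ sumℤ-filter (flats N) Q? g ⟩
    sumℤ (flats N) (λ Y → 𝟙 (Q? Y) *ℤ g Y)
      ≡⟨ sumℤ-filter all (flat? N) (λ Y → 𝟙 (Q? Y) *ℤ g Y) ⟩
    sumℤ all (λ Y → 𝟙 (flat? N Y) *ℤ (𝟙 (Q? Y) *ℤ g Y))
      ≡⟨ sym (sumℤ-allSubsets-△ (size M) (∁ G) (λ Y → 𝟙 (flat? N Y) *ℤ (𝟙 (Q? Y) *ℤ g Y))) ⟩
    sumℤ all (λ K → 𝟙 (flat? N (∁ G △ K)) *ℤ (𝟙 (Q? (∁ G △ K)) *ℤ g (∁ G △ K)))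
      ≡⟨ sumℤ-cong all (λ K → trans (𝟙-*-assoc (flat? N (∁ G △ K)) (Q? (∁ G △ K)) _)
           (𝟙-*-cong₂ (flat? N (∁ G △ K) ×-dec Q? (∁ G △ K)) (T? K) (to′ K) (from′ K) (value′ K))) ⟩
    sumℤ all (λ K → 𝟙 (T? K) *ℤ h K) ∎
    where
    open ≡-Reasoning
    to′ : (K : Subset (size M)) → Flat N (∁ G △ K) × Q (∁ G △ K) → T K
    to′ K (flat , q) with flat-interval⁻ K flat
    ... | flat-K , F⊆K , K⊆G = to K flat-K F⊆K K⊆G (subst Q (∁△≡∪∁ K⊆G) q)
    from′ : (K : Subset (size M)) → T K → Flat N (∁ G △ K) × Q (∁ G △ K)
    from′ K t with from K t
    ... | flat-K , F⊆K , K⊆G , q = flat-interval⁺ K flat-K F⊆K K⊆G , subst Q (sym (∁△≡∪∁ K⊆G)) q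
    value′ : (K : Subset (size M)) → Flat N (∁ G △ K) × Q (∁ G △ K) → g (∁ G △ K) ≡ h K
    value′ K (flat , _) with flat-interval⁻ K flat
    ... | _ , F⊆K , K⊆G = trans (cong g (∁△≡∪∁ K⊆G)) (value K F⊆K K⊆G)

  mobFuel-interval : ∀ f {H} → F ⊆ H → H ⊆ G → mobFuel N f (H ∪ ∁ G) ≡ mobius M F f H
  mobFuel-interval zero    F⊆H H⊆G = refl
  mobFuel-interval (suc f) {H} F⊆H H⊆G with (H ∪ ∁ G) ≟S bottom N | H ≟S F
  ... | yes _         | yes _   = refl
  ... | yes H∪∁G≡0̂   | no H≢F  = contradiction (∪∁-injective H⊆G F⊆G (trans H∪∁G≡0̂ bottom-interval)) H≢F
  ... | no  H∪∁G≢0̂   | yes H≡F = contradiction (trans (cong (_∪ ∁ G) H≡F) (sym bottom-interval)) H∪∁G≢0̂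
  ... | no  _         | no  _   = cong -_ (sumℤ-flats-interval
      (λ Y → bottom N ⊆? Y ×-dec Y ⊂? (H ∪ ∁ G)) (λ K → flat? M K ×-dec (F ⊆? K ×-dec K ⊂? H))
      (mobFuel N f) (mobius M F f) to from (λ K F⊆K K⊆G → mobFuel-interval f F⊆K K⊆G))
    where
    to : ∀ K → Flat M K → F ⊆ K → K ⊆ G → bottom N ⊆ K ∪ ∁ G × K ∪ ∁ G ⊂ H ∪ ∁ G →
         Flat M K × F ⊆ K × K ⊂ H
    to K flat F⊆K K⊆G (_ , K∪∁G⊂H∪∁G) = flat , F⊆K , ∪∁-⊂⁻ K⊆G K∪∁G⊂H∪∁G
    from : ∀ K → Flat M K × F ⊆ K × K ⊂ H →
           Flat M K × F ⊆ K × K ⊆ G × (bottom N ⊆ K ∪ ∁ G × K ∪ ∁ G ⊂ H ∪ ∁ G)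
    from K (flat , F⊆K , K⊂H) =
      flat , F⊆K , ⊆-trans (proj₁ K⊂H) H⊆G ,
      subst (_⊆ K ∪ ∁ G) (sym bottom-interval) (∪-monoˡ-⊆ (∁ G) F⊆K) , ∪∁-⊂⁺ H⊆G K⊂H

  χcoeff-interval : ∀ a → χcoeff N a ≡ χ-interval M F G a
  χcoeff-interval a = sumℤ-flats-interval (λ Y → crk N Y ℕ.≟ a)
    (λ K → flat? M K ×-dec (F ⊆? K ×-dec (K ⊆? G ×-dec (r G ∸ r K ℕ.≟ a)))) (μ₀ N) (μ M F)
    (λ K flat F⊆K K⊆G crk≡a → flat , F⊆K , K⊆G , trans (sym (crk-interval F⊆K K⊆G)) crk≡a)
    (λ K (flat , F⊆K , K⊆G , corank≡a) → flat , F⊆K , K⊆G , trans (crk-interval F⊆K K⊆G) corank≡a)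
    (λ K F⊆K K⊆G → mobFuel-interval (suc (size M)) F⊆K K⊆G)

module _ {M : RawMatroid} (isM : IsMatroid M) where

  private
    all : List (Subset (size M))
    all = allSubsets (size M)

    below? : (H F : Subset (size M)) → Dec (Flat M F × F ⊆ H)
    below? H F = flat? M F ×-dec F ⊆? H

    K⊂H-shrinks : ∀ {f} {K H : Subset (size M)} → ∣ H ∣ < suc f → K ⊂ H → ∣ K ∣ < f
    K⊂H-shrinks ∣H∣<1+f K⊂H = ℕP.<-≤-trans (p⊂q⇒∣p∣<∣q∣ K⊂H) (ℕP.≤-pred ∣H∣<1+f)

  mobius-fuel : ∀ f f′ F H → ∣ H ∣ < f → ∣ H ∣ < f′ → mobius M F f H ≡ mobius M F f′ H
  mobius-fuel (suc f) (suc f′) F H ∣H∣<f ∣H∣<f′ with H ≟S F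
  ... | yes _ = refl
  ... | no  _ = cong -_ (sumℤ-cong all λ K → 𝟙-*-cong (flat? M K ×-dec (F ⊆? K ×-dec K ⊂? H))
                  λ (_ , _ , K⊂H) → mobius-fuel f f′ F K (K⊂H-shrinks ∣H∣<f K⊂H) (K⊂H-shrinks ∣H∣<f′ K⊂H))

  μ-unfold : ∀ F H → μ M F H ≡
    𝟙 (H ≟S F) - sumℤ all (λ K → 𝟙 (flat? M K ×-dec (F ⊆? K ×-dec K ⊂? H)) *ℤ μ M F K)
  μ-unfold F H with H ≟S F
  ... | yes refl = sym (cong (_-_ (+ 1)) (sumℤ-zero all λ K →
          cong (_*ℤ μ M F K) (𝟙-no (flat? M K ×-dec (F ⊆? K ×-dec K ⊂? F))
                                   λ (_ , F⊆K , K⊂F) → ⊂-irref refl (⊂-⊆-trans K⊂F F⊆K))))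
  ... | no  _    = trans (cong -_ (sumℤ-cong all λ K → 𝟙-*-cong (flat? M K ×-dec (F ⊆? K ×-dec K ⊂? H))
                     λ (_ , _ , K⊂H) → mobius-fuel (size M) (suc (size M)) F K
                                         (K⊂H-shrinks (s≤s (∣p∣≤n H)) K⊂H)
                                         (ℕP.m≤n⇒m≤1+n (K⊂H-shrinks (s≤s (∣p∣≤n H)) K⊂H))))
                         (sym (ℤP.+-identityˡ _))

  bottom⊂flat : (H : Subset (size M)) → Flat M H → H ≢ bottom M → bottom M ⊂ H
  bottom⊂flat H flat H≢0̂ with bottom M ⊂? H
  ... | yes 0̂⊂H = 0̂⊂H
  ... | no  0̂⊄H = contradiction (⊆-antisym H⊆0̂ (bottom⊆flat isM H flat)) H≢0̂
    where
    H⊆0̂ : H ⊆ bottom M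
    H⊆0̂ {x} x∈H with x ∈? bottom M
    ... | yes x∈0̂ = x∈0̂
    ... | no  x∉0̂ = contradiction ((λ {y} → bottom⊆flat isM H flat {y}) , x , x∈H , x∉0̂) 0̂⊄H

  -- Unfold μ(F, H) = δ(F, H) − Σ_{F ≤ K < H} μ(F, K) and swap the sums: the strictly smaller K
  -- contribute Σ_{K < H} δ(K, 0̂) by induction on ∣ H ∣.
  sumℤ-μ-below : (H : Subset (size M)) → Flat M H →
    sumℤ all (λ F → 𝟙 (flat? M F ×-dec F ⊆? H) *ℤ μ M F H) ≡ 𝟙 (H ≟S bottom M)
  sumℤ-μ-below H = go (suc (size M)) H (s≤s (∣p∣≤n H))
    where
    go : ∀ b H → ∣ H ∣ < b → Flat M H → sumℤ all (λ F → 𝟙 (below? H F) *ℤ μ M F H) ≡ 𝟙 (H ≟S bottom M)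
    go (suc b) H ∣H∣<b flat-H = begin
      sumℤ all (λ F → 𝟙 (below? H F) *ℤ μ M F H)
        ≡⟨ sumℤ-cong all (λ F → trans (cong (𝟙 (below? H F) *ℤ_) (μ-unfold F H))
                                      (ℤP.*-distribˡ-+ (𝟙 (below? H F)) (𝟙 (H ≟S F)) (- strict F))) ⟩
      sumℤ all (λ F → 𝟙 (below? H F) *ℤ 𝟙 (H ≟S F) + 𝟙 (below? H F) *ℤ - strict F)
        ≡⟨ sumℤ-+ all (λ F → 𝟙 (below? H F) *ℤ 𝟙 (H ≟S F)) (λ F → 𝟙 (below? H F) *ℤ - strict F) ⟩
      sumℤ all (λ F → 𝟙 (below? H F) *ℤ 𝟙 (H ≟S F)) + sumℤ all (λ F → 𝟙 (below? H F) *ℤ - strict F)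
        ≡⟨ cong₂ _+_ diagonal (trans (sumℤ-cong all (λ F → sym (ℤP.neg-distribʳ-* (𝟙 (below? H F)) (strict F))))
                                     (trans (sumℤ-neg all (λ F → 𝟙 (below? H F) *ℤ strict F))
                                            (cong -_ off-diagonal))) ⟩
      + 1 - 𝟙 (bottom M ⊂? H)
        ≡⟨ one-minus ⟩
      𝟙 (H ≟S bottom M) ∎
      where
      open ≡-Reasoning
      between? : ∀ F K → Dec (Flat M K × F ⊆ K × K ⊂ H)
      between? F K = flat? M K ×-dec (F ⊆? K ×-dec K ⊂? H)
      strict : Subset (size M) → ℤ
      strict F = sumℤ all (λ K → 𝟙 (between? F K) *ℤ μ M F K)
      diagonal : sumℤ all (λ F → 𝟙 (below? H F) *ℤ 𝟙 (H ≟S F)) ≡ + 1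
      diagonal = trans (sumℤ-cong all λ F → trans (sym (𝟙-× (below? H F) (H ≟S F)))
                         (trans (𝟙-cong (below? H F ×-dec (H ≟S F)) (F ≟S H) (sym ∘ proj₂)
                                        λ { refl → (flat-H , ⊆-refl) , refl })
                                (sym (ℤP.*-identityʳ _))))
                       (sumℤ-allSubsets-𝟙≡ (size M) H (λ _ → + 1))
      off-diagonal : sumℤ all (λ F → 𝟙 (below? H F) *ℤ strict F) ≡ 𝟙 (bottom M ⊂? H)
      off-diagonal = begin
        sumℤ all (λ F → 𝟙 (below? H F) *ℤ strict F)
          ≡⟨ sumℤ-cong all (λ F → sym (sumℤ-*ˡ all (𝟙 (below? H F)) (λ K → 𝟙 (between? F K) *ℤ μ M F K))) ⟩
        sumℤ all (λ F → sumℤ all (λ K → 𝟙 (below? H F) *ℤ (𝟙 (between? F K) *ℤ μ M F K)))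
          ≡⟨ sumℤ-comm all all (λ F K → 𝟙 (below? H F) *ℤ (𝟙 (between? F K) *ℤ μ M F K)) ⟩
        sumℤ all (λ K → sumℤ all (λ F → 𝟙 (below? H F) *ℤ (𝟙 (between? F K) *ℤ μ M F K)))
          ≡⟨ sumℤ-cong all (λ K → sumℤ-cong all λ F →
               𝟙-*-𝟙-cong (below? H F) (between? F K) (flat? M K ×-dec K ⊂? H) (below? K F)
                 (λ ((flat-F , _) , (flat-K , F⊆K , K⊂H)) → (flat-K , K⊂H) , (flat-F , F⊆K))
                 (λ ((flat-K , K⊂H) , (flat-F , F⊆K)) → (flat-F , ⊆-trans F⊆K (proj₁ K⊂H)) , (flat-K , F⊆K , K⊂H))) ⟩
        sumℤ all (λ K → sumℤ all (λ F → 𝟙 (flat? M K ×-dec K ⊂? H) *ℤ (𝟙 (below? K F) *ℤ μ M F K)))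
          ≡⟨ sumℤ-cong all (λ K → sumℤ-*ˡ all (𝟙 (flat? M K ×-dec K ⊂? H)) (λ F → 𝟙 (below? K F) *ℤ μ M F K)) ⟩
        sumℤ all (λ K → 𝟙 (flat? M K ×-dec K ⊂? H) *ℤ sumℤ all (λ F → 𝟙 (below? K F) *ℤ μ M F K))
          ≡⟨ sumℤ-cong all (λ K → 𝟙-*-cong (flat? M K ×-dec K ⊂? H) λ (flat-K , K⊂H) →
               go b K (K⊂H-shrinks ∣H∣<b K⊂H) flat-K) ⟩
        sumℤ all (λ K → 𝟙 (flat? M K ×-dec K ⊂? H) *ℤ 𝟙 (K ≟S bottom M))
          ≡⟨ sumℤ-cong all (λ K → trans (sym (𝟙-× (flat? M K ×-dec K ⊂? H) (K ≟S bottom M)))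
               (trans (𝟙-cong ((flat? M K ×-dec K ⊂? H) ×-dec (K ≟S bottom M)) ((K ≟S bottom M) ×-dec (bottom M ⊂? H))
                        (λ { ((_ , K⊂H) , refl) → refl , K⊂H })
                        (λ { (refl , 0̂⊂H) → (bottom-flat isM , 0̂⊂H) , refl }))
                      (𝟙-× (K ≟S bottom M) (bottom M ⊂? H)))) ⟩
        sumℤ all (λ K → 𝟙 (K ≟S bottom M) *ℤ 𝟙 (bottom M ⊂? H))
          ≡⟨ sumℤ-allSubsets-𝟙≡ (size M) (bottom M) (λ _ → 𝟙 (bottom M ⊂? H)) ⟩
        𝟙 (bottom M ⊂? H) ∎
      one-minus : + 1 - 𝟙 (bottom M ⊂? H) ≡ 𝟙 (H ≟S bottom M)
      one-minus with H ≟S bottom M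
      ... | yes refl = cong (_-_ (+ 1)) (𝟙-no (bottom M ⊂? bottom M) (⊂-irref refl))
      ... | no  H≢0̂ = cong (_-_ (+ 1)) (𝟙-yes (bottom M ⊂? H) (bottom⊂flat H flat-H H≢0̂))

  sumℤ-χ-interval : (G : Subset (size M)) → Flat M G → ∀ a →
    sumℤ all (λ F → 𝟙 (flat? M F ×-dec F ⊆? G) *ℤ χ-interval M F G a) ≡ 𝟙 (rank M G ℕ.≟ a)
  sumℤ-χ-interval G flat-G a = begin
    sumℤ all (λ F → 𝟙 (below? G F) *ℤ χ-interval M F G a)
      ≡⟨ sumℤ-cong all (λ F → sym (sumℤ-*ˡ all (𝟙 (below? G F)) (λ K → 𝟙 (inside? F K) *ℤ μ M F K))) ⟩
    sumℤ all (λ F → sumℤ all (λ K → 𝟙 (below? G F) *ℤ (𝟙 (inside? F K) *ℤ μ M F K)))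
      ≡⟨ sumℤ-comm all all (λ F K → 𝟙 (below? G F) *ℤ (𝟙 (inside? F K) *ℤ μ M F K)) ⟩
    sumℤ all (λ K → sumℤ all (λ F → 𝟙 (below? G F) *ℤ (𝟙 (inside? F K) *ℤ μ M F K)))
      ≡⟨ sumℤ-cong all (λ K → sumℤ-cong all λ F →
           𝟙-*-𝟙-cong (below? G F) (inside? F K) (top? K) (below? K F)
             (λ ((flat-F , _) , (flat-K , F⊆K , K⊆G , rk≡a)) → (flat-K , K⊆G , rk≡a) , (flat-F , F⊆K))
             (λ ((flat-K , K⊆G , rk≡a) , (flat-F , F⊆K)) → (flat-F , ⊆-trans F⊆K K⊆G) , (flat-K , F⊆K , K⊆G , rk≡a))) ⟩
    sumℤ all (λ K → sumℤ all (λ F → 𝟙 (top? K) *ℤ (𝟙 (below? K F) *ℤ μ M F K)))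
      ≡⟨ sumℤ-cong all (λ K → sumℤ-*ˡ all (𝟙 (top? K)) (λ F → 𝟙 (below? K F) *ℤ μ M F K)) ⟩
    sumℤ all (λ K → 𝟙 (top? K) *ℤ sumℤ all (λ F → 𝟙 (below? K F) *ℤ μ M F K))
      ≡⟨ sumℤ-cong all (λ K → 𝟙-*-cong (top? K) λ (flat-K , _) → sumℤ-μ-below K flat-K) ⟩
    sumℤ all (λ K → 𝟙 (top? K) *ℤ 𝟙 (K ≟S bottom M))
      ≡⟨ sumℤ-cong all (λ K → trans (sym (𝟙-× (top? K) (K ≟S bottom M)))
           (trans (𝟙-cong (top? K ×-dec (K ≟S bottom M)) ((K ≟S bottom M) ×-dec (rank M G ℕ.≟ a))
                    (λ { ((_ , _ , rk≡a) , refl) → refl , trans (cong (rank M G ∸_) (sym (rank-bottom isM))) rk≡a })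
                    (λ { (refl , rG≡a) → (bottom-flat isM , bottom⊆flat isM G flat-G ,
                                          trans (cong (rank M G ∸_) (rank-bottom isM)) rG≡a) , refl }))
                  (𝟙-× (K ≟S bottom M) (rank M G ℕ.≟ a)))) ⟩
    sumℤ all (λ K → 𝟙 (K ≟S bottom M) *ℤ 𝟙 (rank M G ℕ.≟ a))
      ≡⟨ sumℤ-allSubsets-𝟙≡ (size M) (bottom M) (λ _ → 𝟙 (rank M G ℕ.≟ a)) ⟩
    𝟙 (rank M G ℕ.≟ a) ∎
    where
    open ≡-Reasoning
    inside? : ∀ F K → Dec (Flat M K × F ⊆ K × K ⊆ G × rank M G ∸ rank M K ≡ a)
    inside? F K = flat? M K ×-dec (F ⊆? K ×-dec (K ⊆? G ×-dec (rank M G ∸ rank M K ℕ.≟ a)))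
    top? : ∀ K → Dec (Flat M K × K ⊆ G × rank M G ∸ rank M K ≡ a)
    top? K = flat? M K ×-dec (K ⊆? G ×-dec (rank M G ∸ rank M K ℕ.≟ a))

module _ (P : RawMatroid → ℕ → ℤ) (kl : IsKL P) {M : RawMatroid} (isM : IsMatroid M) where

  open IsKL kl

  private
    all : List (Subset (size M))
    all = allSubsets (size M)
    r : Subset (size M) → ℕ
    r = rank M
    above? : (F G : Subset (size M)) → Dec (Flat M G × F ⊆ G)
    above? F G = flat? M G ×-dec F ⊆? G
    below? : (G F : Subset (size M)) → Dec (Flat M F × F ⊆ G)
    below? G F = flat? M F ×-dec F ⊆? G

  klLHS-con : (F : Subset (size M)) → Flat M F → ∀ i →
    klLHS P (con M F) i ≡ sumℤ all (λ G → 𝟙 (flat? M G ×-dec F ⊆? G) *ℤ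
                            sumℤ (upTo (suc i)) (λ a → χ-interval M F G a *ℤ P (con M G) (i ∸ a)))
  klLHS-con F flat-F i = begin
    klLHS P (con M F) i
      ≡⟨ recursion (con M F) (con-isMatroid isM F) i ⟩
    klRHS P (con M F) i
      ≡⟨ sumℤ-filter all (flat? (con M F)) (λ G → sumℤ (upTo (suc i)) (summand G)) ⟩
    sumℤ all (λ G → 𝟙 (flat? (con M F) G) *ℤ sumℤ (upTo (suc i)) (summand G))
      ≡⟨ sumℤ-cong all (λ G → 𝟙-*-cong₂ (flat? (con M F) G) (above? F G)
           (λ flat → swap (flat-con⁻ isM F G flat))
           (λ (flat-G , F⊆G) → flat-con⁺ isM F G F⊆G flat-G)
           (λ flat → sumℤ-cong (upTo (suc i)) (λ a → summand-interval G (flat-con⁻ isM F G flat) a))) ⟩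
    sumℤ all (λ G → 𝟙 (above? F G) *ℤ sumℤ (upTo (suc i)) (λ a → χ-interval M F G a *ℤ P (con M G) (i ∸ a))) ∎
    where
    open ≡-Reasoning
    summand : Subset (size M) → ℕ → ℤ
    summand G a = χcoeff (loc (con M F) G) a *ℤ P (con (con M F) G) (i ∸ a)
    summand-interval : ∀ G → F ⊆ G × Flat M G → ∀ a → summand G a ≡ χ-interval M F G a *ℤ P (con M G) (i ∸ a)
    summand-interval G (F⊆G , flat-G) a = cong₂ _*ℤ_
      (χcoeff-interval isM flat-F flat-G F⊆G a)
      (invariant _ _ (con-isMatroid (con-isMatroid isM F) G) (con-isMatroid isM G) (con-con≃ isM F⊆G) (i ∸ a))

  -- After summing over F ≤ G first, Σ_{F ≤ G} χ_{[F,G]}(t) = t^{rk G} collapses the sum over a.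
  sumℤ-klLHS-con : ∀ i → sumℤ (flats M) (λ F → klLHS P (con M F) i) ≡
                         sumℤ (flats M) (λ G → 𝟙 (r G ℕ.<? suc i) *ℤ P (con M G) (i ∸ r G))
  sumℤ-klLHS-con i = begin
    sumℤ (flats M) (λ F → klLHS P (con M F) i)
      ≡⟨ sumℤ-filter all (flat? M) (λ F → klLHS P (con M F) i) ⟩
    sumℤ all (λ F → 𝟙 (flat? M F) *ℤ klLHS P (con M F) i)
      ≡⟨ sumℤ-cong all (λ F → 𝟙-*-cong (flat? M F) (λ flat-F → klLHS-con F flat-F i)) ⟩
    sumℤ all (λ F → 𝟙 (flat? M F) *ℤ sumℤ all (λ G → 𝟙 (above? F G) *ℤ S F G))
      ≡⟨ sumℤ-cong all (λ F → sym (sumℤ-*ˡ all (𝟙 (flat? M F)) (λ G → 𝟙 (above? F G) *ℤ S F G))) ⟩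
    sumℤ all (λ F → sumℤ all (λ G → 𝟙 (flat? M F) *ℤ (𝟙 (above? F G) *ℤ S F G)))
      ≡⟨ sumℤ-comm all all (λ F G → 𝟙 (flat? M F) *ℤ (𝟙 (above? F G) *ℤ S F G)) ⟩
    sumℤ all (λ G → sumℤ all (λ F → 𝟙 (flat? M F) *ℤ (𝟙 (above? F G) *ℤ S F G)))
      ≡⟨ sumℤ-cong all (λ G → sumℤ-cong all λ F →
           𝟙-*-𝟙-cong (flat? M F) (above? F G) (flat? M G) (below? G F)
             (λ (flat-F , flat-G , F⊆G) → flat-G , flat-F , F⊆G)
             (λ (flat-G , flat-F , F⊆G) → flat-F , flat-G , F⊆G)) ⟩
    sumℤ all (λ G → sumℤ all (λ F → 𝟙 (flat? M G) *ℤ (𝟙 (below? G F) *ℤ S F G)))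
      ≡⟨ sumℤ-cong all (λ G → sumℤ-*ˡ all (𝟙 (flat? M G)) (λ F → 𝟙 (below? G F) *ℤ S F G)) ⟩
    sumℤ all (λ G → 𝟙 (flat? M G) *ℤ sumℤ all (λ F → 𝟙 (below? G F) *ℤ S F G))
      ≡⟨ sumℤ-cong all (λ G → 𝟙-*-cong (flat? M G) (collapse G)) ⟩
    sumℤ all (λ G → 𝟙 (flat? M G) *ℤ (𝟙 (r G ℕ.<? suc i) *ℤ P (con M G) (i ∸ r G)))
      ≡⟨ sym (sumℤ-filter all (flat? M) (λ G → 𝟙 (r G ℕ.<? suc i) *ℤ P (con M G) (i ∸ r G))) ⟩
    sumℤ (flats M) (λ G → 𝟙 (r G ℕ.<? suc i) *ℤ P (con M G) (i ∸ r G)) ∎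
    where
    open ≡-Reasoning
    S : Subset (size M) → Subset (size M) → ℤ
    S F G = sumℤ (upTo (suc i)) (λ a → χ-interval M F G a *ℤ P (con M G) (i ∸ a))
    collapse : ∀ G → Flat M G →
      sumℤ all (λ F → 𝟙 (below? G F) *ℤ S F G) ≡ 𝟙 (r G ℕ.<? suc i) *ℤ P (con M G) (i ∸ r G)
    collapse G flat-G = begin
      sumℤ all (λ F → 𝟙 (below? G F) *ℤ S F G)
        ≡⟨ sumℤ-cong all (λ F → sym (sumℤ-*ˡ (upTo (suc i)) (𝟙 (below? G F)) (λ a → χ-interval M F G a *ℤ φ a))) ⟩
      sumℤ all (λ F → sumℤ (upTo (suc i)) (λ a → 𝟙 (below? G F) *ℤ (χ-interval M F G a *ℤ φ a)))
        ≡⟨ sumℤ-comm all (upTo (suc i)) (λ F a → 𝟙 (below? G F) *ℤ (χ-interval M F G a *ℤ φ a)) ⟩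
      sumℤ (upTo (suc i)) (λ a → sumℤ all (λ F → 𝟙 (below? G F) *ℤ (χ-interval M F G a *ℤ φ a)))
        ≡⟨ sumℤ-cong (upTo (suc i)) (λ a →
             trans (sumℤ-cong all (λ F → sym (ℤP.*-assoc (𝟙 (below? G F)) (χ-interval M F G a) (φ a))))
                   (sumℤ-*ʳ all (φ a) (λ F → 𝟙 (below? G F) *ℤ χ-interval M F G a))) ⟩
      sumℤ (upTo (suc i)) (λ a → sumℤ all (λ F → 𝟙 (below? G F) *ℤ χ-interval M F G a) *ℤ φ a)
        ≡⟨ sumℤ-cong (upTo (suc i)) (λ a → cong (_*ℤ φ a) (sumℤ-χ-interval isM G flat-G a)) ⟩
      sumℤ (upTo (suc i)) (λ a → 𝟙 (r G ℕ.≟ a) *ℤ φ a)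
        ≡⟨ sumℤ-upTo-𝟙≡ (suc i) (r G) φ ⟩
      𝟙 (r G ℕ.<? suc i) *ℤ φ (r G) ∎
      where
      φ : ℕ → ℤ
      φ a = P (con M G) (i ∸ a)

coeffℤ-∸ : (Q : RawMatroid → ℕ → ℤ) (N : RawMatroid) (a b : ℕ) →
           coeffℤ Q N (+ a - + b) ≡ 𝟙 (b ℕ.<? suc a) *ℤ Q N (a ∸ b)
coeffℤ-∸ Q N a b with b ℕ.≤? a
... | yes b≤a = trans (cong (coeffℤ Q N) (trans (ℤP.m-n≡m⊖n a b) (ℤP.⊖-≥ b≤a)))
                      (sym (trans (cong (_*ℤ Q N (a ∸ b)) (𝟙-yes (b ℕ.<? suc a) (s≤s b≤a))) (ℤP.*-identityˡ _)))
... | no  b≰a = trans (cong (coeffℤ Q N) (trans (ℤP.m-n≡m⊖n a b) (ℤP.⊖-≰ b≰a)))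
                      (trans (negative (ℕP.m<n⇒0<n∸m (ℕP.≰⇒> b≰a)))
                             (sym (cong (_*ℤ Q N (a ∸ b)) (𝟙-no (b ℕ.<? suc a) (b≰a ∘ ℕP.≤-pred)))))
  where
  negative : ∀ {k} → 0 < k → coeffℤ Q N (- (+ k)) ≡ + 0
  negative {suc k} _ = refl

klLHS≡ : (Q : RawMatroid → ℕ → ℤ) (N : RawMatroid) (i : ℕ) →
         klLHS Q N i ≡ 𝟙 (i ℕ.<? suc (totalRank N)) *ℤ Q N (totalRank N ∸ i)
klLHS≡ Q N i with i ℕ.≤ᵇ totalRank N in i≤ᵇn
... | true  = sym (trans (cong (_*ℤ Q N (totalRank N ∸ i)) (𝟙-yes (i ℕ.<? suc (totalRank N)) i<1+n))
                         (ℤP.*-identityˡ (Q N (totalRank N ∸ i))))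
  where
  i<1+n : i < suc (totalRank N)
  i<1+n = s≤s (ℕP.≤ᵇ⇒≤ i (totalRank N) (subst T (sym i≤ᵇn) tt))
... | false = sym (cong (_*ℤ Q N (totalRank N ∸ i)) (𝟙-no (i ℕ.<? suc (totalRank N)) i≮1+n))
  where
  i≮1+n : ¬ i < suc (totalRank N)
  i≮1+n = subst T i≤ᵇn ∘ ℕP.≤⇒≤ᵇ ∘ ℕP.≤-pred

sumℤ-flats-by-corank : (N : RawMatroid) (g : ℕ → ℤ) →
  sumℤ (flats N) (g ∘ crk N) ≡ sumℤ (upTo (suc (totalRank N))) (λ k → + W N k *ℤ g k)
sumℤ-flats-by-corank N g = sumℤ-by-value (flats N) (crk N) _ g (λ F → s≤s (ℕP.m∸n≤m _ (rank N F)))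

W-top≡1 : {N : RawMatroid} → IsMatroid N → + W N (totalRank N) ≡ + 1
W-top≡1 {N} isN = begin
  + W N n
    ≡⟨ length-filter (flats N) (λ F → crk N F ℕ.≟ n) ⟩
  sumℤ (flats N) (λ F → 𝟙 (crk N F ℕ.≟ n))
    ≡⟨ sumℤ-filter (allSubsets (size N)) (flat? N) (λ F → 𝟙 (crk N F ℕ.≟ n)) ⟩
  sumℤ (allSubsets (size N)) (λ F → 𝟙 (flat? N F) *ℤ 𝟙 (crk N F ℕ.≟ n))
    ≡⟨ sumℤ-cong (allSubsets (size N)) (λ F → trans (sym (𝟙-× (flat? N F) (crk N F ℕ.≟ n)))
         (trans (𝟙-cong (flat? N F ×-dec (crk N F ℕ.≟ n)) (F ≟S bottom N) (to F) (from F))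
                (sym (ℤP.*-identityʳ _)))) ⟩
  sumℤ (allSubsets (size N)) (λ F → 𝟙 (F ≟S bottom N) *ℤ + 1)
    ≡⟨ sumℤ-allSubsets-𝟙≡ (size N) (bottom N) (λ _ → + 1) ⟩
  + 1 ∎
  where
  open ≡-Reasoning
  n : ℕ
  n = totalRank N
  to : ∀ F → Flat N F × crk N F ≡ n → F ≡ bottom N
  to F (flat , crk≡n) = flat-rank0⇒≡bottom isN F flat
    (ℕP.∸-cancelˡ-≡ (rank≤totalRank isN F) z≤n crk≡n)
  from : ∀ F → F ≡ bottom N → Flat N F × crk N F ≡ n
  from F refl = bottom-flat isN , cong (n ∸_) (rank-bottom isN)

module _ {M : ℕ → RawMatroid} (nice : NiceFamily M) {P : RawMatroid → ℕ → ℤ} (kl : IsKL P) where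

  open NiceFamily nice
  open IsKL kl

  P-con : ∀ d F → Flat (M d) F → ∀ j → P (con (M d) F) j ≡ P (M (crk (M d) F)) j
  P-con d F flat = invariant _ _ (con-isMatroid (isMatroid d) F) (isMatroid _) (contraction d F flat)

  klLHS-con≡coeffℤ : ∀ d i F → Flat (M d) F →
    klLHS P (con (M d) F) i ≡ coeffℤ P (M (crk (M d) F)) (+ crk (M d) F - + i)
  klLHS-con≡coeffℤ d i F flat = begin
    klLHS P (con (M d) F) i
      ≡⟨ klLHS≡ P (con (M d) F) i ⟩
    𝟙 (i ℕ.<? suc (totalRank (con (M d) F))) *ℤ P (con (M d) F) (totalRank (con (M d) F) ∸ i)
      ≡⟨ cong (λ c → 𝟙 (i ℕ.<? suc c) *ℤ P (con (M d) F) (c ∸ i)) (totalRank-con (M d) F) ⟩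
    𝟙 (i ℕ.<? suc c) *ℤ P (con (M d) F) (c ∸ i)
      ≡⟨ cong (𝟙 (i ℕ.<? suc c) *ℤ_) (P-con d F flat (c ∸ i)) ⟩
    𝟙 (i ℕ.<? suc c) *ℤ P (M c) (c ∸ i)
      ≡⟨ sym (coeffℤ-∸ P (M c) c i) ⟩
    coeffℤ P (M c) (+ c - + i) ∎
    where
    open ≡-Reasoning
    c : ℕ
    c = crk (M d) F

  𝟙*P-con≡coeffℤ : ∀ d i F → Flat (M d) F →
    𝟙 (rank (M d) F ℕ.<? suc i) *ℤ P (con (M d) F) (i ∸ rank (M d) F) ≡
    coeffℤ P (M (crk (M d) F)) (+ i - + d + + crk (M d) F)
  𝟙*P-con≡coeffℤ d i F flat = begin
    𝟙 (r ℕ.<? suc i) *ℤ P (con (M d) F) (i ∸ r)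
      ≡⟨ cong (𝟙 (r ℕ.<? suc i) *ℤ_) (P-con d F flat (i ∸ r)) ⟩
    𝟙 (r ℕ.<? suc i) *ℤ P (M c) (i ∸ r)
      ≡⟨ sym (coeffℤ-∸ P (M c) i r) ⟩
    coeffℤ P (M c) (+ i - + r)
      ≡⟨ cong (coeffℤ P (M c)) (trans (sym (cancel (+ i) (+ d) (+ r))) (cong (_+_ (+ i - + d)) (sym +c≡d-r))) ⟩
    coeffℤ P (M c) (+ i - + d + + c) ∎
    where
    open ≡-Reasoning
    r : ℕ
    r = rank (M d) F
    c : ℕ
    c = crk (M d) F
    +c≡d-r : + c ≡ + d - + r
    +c≡d-r = trans (cong (λ n → + (n ∸ r)) (rank-d d)) (sym (trans (ℤP.m-n≡m⊖n d r) (ℤP.⊖-≥ r≤d)))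
      where
      r≤d : r ≤ d
      r≤d = subst (r ≤_) (rank-d d) (rank≤totalRank (isMatroid d) F)
    cancel : ∀ x y z → x - y + (y - z) ≡ x - z
    cancel = solve-∀

  sumℤ-W-identity : ∀ d i →
    sumℤ (upTo (suc d)) (λ k → + W (M d) k *ℤ coeffℤ P (M k) (+ k - + i)) ≡
    sumℤ (upTo (suc d)) (λ k → + W (M d) k *ℤ coeffℤ P (M k) (+ i - + d + + k))
  sumℤ-W-identity d i = begin
    sumℤ (upTo (suc d)) (λ k → + W (M d) k *ℤ top k)
      ≡⟨ cong (λ n → sumℤ (upTo (suc n)) (λ k → + W (M d) k *ℤ top k)) (sym (rank-d d)) ⟩
    sumℤ (upTo (suc (totalRank (M d)))) (λ k → + W (M d) k *ℤ top k)
      ≡⟨ sym (sumℤ-flats-by-corank (M d) top) ⟩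
    sumℤ (flats (M d)) (top ∘ crk (M d))
      ≡⟨ sumℤ-filter-cong (allSubsets _) (flat? (M d)) (λ F flat → sym (klLHS-con≡coeffℤ d i F flat)) ⟩
    sumℤ (flats (M d)) (λ F → klLHS P (con (M d) F) i)
      ≡⟨ sumℤ-klLHS-con P kl (isMatroid d) i ⟩
    sumℤ (flats (M d)) (λ F → 𝟙 (rank (M d) F ℕ.<? suc i) *ℤ P (con (M d) F) (i ∸ rank (M d) F))
      ≡⟨ sumℤ-filter-cong (allSubsets _) (flat? (M d)) (𝟙*P-con≡coeffℤ d i) ⟩
    sumℤ (flats (M d)) (bottom-up ∘ crk (M d))
      ≡⟨ sumℤ-flats-by-corank (M d) bottom-up ⟩
    sumℤ (upTo (suc (totalRank (M d)))) (λ k → + W (M d) k *ℤ bottom-up k)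
      ≡⟨ cong (λ n → sumℤ (upTo (suc n)) (λ k → + W (M d) k *ℤ bottom-up k)) (rank-d d) ⟩
    sumℤ (upTo (suc d)) (λ k → + W (M d) k *ℤ bottom-up k) ∎
    where
    open ≡-Reasoning
    top bottom-up : ℕ → ℤ
    top k = coeffℤ P (M k) (+ k - + i)
    bottom-up k = coeffℤ P (M k) (+ i - + d + + k)

  W-d-d≡1 : ∀ d → + W (M d) d ≡ + 1
  W-d-d≡1 d = subst (λ n → + W (M d) n ≡ + 1) (rank-d d) (W-top≡1 (isMatroid d))

  top-coefficient-vanishes : ∀ i d → 2 * i < d → coeffℤ P (M d) (+ d - + i) ≡ + 0
  top-coefficient-vanishes i d 2i<d = begin
    coeffℤ P (M d) (+ d - + i)               ≡⟨ coeffℤ-∸ P (M d) d i ⟩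
    𝟙 (i ℕ.<? suc d) *ℤ P (M d) (d ∸ i)      ≡⟨ cong (𝟙 (i ℕ.<? suc d) *ℤ_)
                                                     (degree (M d) (isMatroid d) 0<rk (d ∸ i) rk≤2[d-i]) ⟩
    𝟙 (i ℕ.<? suc d) *ℤ + 0                  ≡⟨ ℤP.*-zeroʳ (𝟙 (i ℕ.<? suc d)) ⟩
    + 0                                      ∎
    where
    open ≡-Reasoning
    0<rk : 0 < totalRank (M d)
    0<rk = subst (0 <_) (sym (rank-d d)) (ℕP.<-≤-trans (s≤s z≤n) 2i<d)
    rk≤2[d-i] : totalRank (M d) ≤ 2 * (d ∸ i)
    rk≤2[d-i] = subst₂ _≤_ (sym (rank-d d)) (sym (ℕP.*-distribˡ-∸ 2 d i)) (ℕP.m+n≤o⇒m≤o∸n d d+2i≤2d)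
      where
      d+2i≤2d : d ℕ.+ 2 * i ≤ 2 * d
      d+2i≤2d = subst (d ℕ.+ 2 * i ≤_) (cong (d ℕ.+_) (sym (ℕP.+-identityʳ d))) (ℕP.+-monoʳ-≤ d (ℕP.<⇒≤ 2i<d))

corollary4p2 : (M : ℕ → RawMatroid) → NiceFamily M →
    (P : RawMatroid → ℕ → ℤ) → IsKL P →
    (i d : ℕ) → 2 * i < d →
    P (M d) i ≡
      sumℤ (upTo d) (λ k → (+ W (M d) k) *ℤ coeffℤ P (M k) (+ k - + i))
      - sumℤ (upTo d) (λ k → (+ W (M d) k) *ℤ coeffℤ P (M k) (+ i - + d + + k))
corollary4p2 M nice P kl i d 2i<d = subtract (begin
  SA                               ≡⟨ sym (drop-zero SA Wd (top-coefficient-vanishes nice kl i d 2i<d)) ⟩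
  SA + Wd *ℤ top d                 ≡⟨ sym (sumℤ-upTo-suc d (λ k → + W (M d) k *ℤ top k)) ⟩
  sumℤ (upTo (suc d)) (λ k → + W (M d) k *ℤ top k)
                                   ≡⟨ sumℤ-W-identity nice kl d i ⟩
  sumℤ (upTo (suc d)) (λ k → + W (M d) k *ℤ bottom-up k)
                                   ≡⟨ sumℤ-upTo-suc d (λ k → + W (M d) k *ℤ bottom-up k) ⟩
  SB + Wd *ℤ bottom-up d           ≡⟨ cong (_+_ SB) (cong₂ _*ℤ_ (W-d-d≡1 nice kl d)
                                                               (cong (coeffℤ P (M d)) (cancel (+ i) (+ d)))) ⟩
  SB + + 1 *ℤ P (M d) i            ≡⟨ cong (_+_ SB) (ℤP.*-identityˡ (P (M d) i)) ⟩
  SB + P (M d) i                   ∎)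
  where
  open ≡-Reasoning
  top bottom-up : ℕ → ℤ
  top k = coeffℤ P (M k) (+ k - + i)
  bottom-up k = coeffℤ P (M k) (+ i - + d + + k)
  SA SB Wd : ℤ
  SA = sumℤ (upTo d) (λ k → (+ W (M d) k) *ℤ top k)
  SB = sumℤ (upTo d) (λ k → (+ W (M d) k) *ℤ bottom-up k)
  Wd = + W (M d) d
  drop-zero : ∀ x c {y} → y ≡ + 0 → x + c *ℤ y ≡ x
  drop-zero x c refl = trans (cong (_+_ x) (ℤP.*-zeroʳ c)) (ℤP.+-identityʳ x)
  cancel : ∀ x y → x - y + y ≡ x
  cancel = solve-∀
  subtract : ∀ {x y z} → x ≡ y + z → z ≡ x - y
  subtract {x} {y} {z} x≡y+z = trans (z≡[y+z]-y y z) (cong (_- y) (sym x≡y+z))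
    where
    z≡[y+z]-y : ∀ y z → z ≡ (y + z) - y
    z≡[y+z]-y = solve-∀
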